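{- Let $\Gamma$ be a distance-regular graph with minimum eigenvalue $\theta_d$ which is geometric with respect to a set $\mathcal{K}$ of Delsarte cliques, and let $C$ be a completely regular code in $\Gamma$ with covering radius $\rho$ and distance partition $C_0=C,C_1,\dots,C_\rho$ such that $\theta_d\in Spec(C)$. Then there are nonzero numbers $a_i$, $i\in\{0,\dots,\rho-1\}$, depending only on $i$ and on the intersection arrays of $C$ and $\Gamma$, such that for every $K\in\mathcal{K}$ with $K\subset C_i\cup C_{i+1}$ we have $|K\cap C_i|=a_i$.
   Context: A distance-regular graph of diameter $d$ and valency $k$ has exactly $d+1$ distinct eigenvalues $\theta_0=k>\dots>\theta_d$ (eigenvalues of its adjacency matrix). A clique of size $1-\frac{k}{\theta_d}$ is a Delsarte clique. $\Gamma$ is geometric with respect to a set $\mathcal{K}$ of Delsarte cliques if every edge lies in exactly one clique of $\mathcal{K}$. The intersection array of a distance-regular graph is $\{\beta_0,\dots,\beta_{d-1};\gamma_1,\dots,\gamma_d\}$ where for vertices $x,y$ at distance $i$, $y$ has $\beta_i$ neighbours at distance $i+1$ and $\gamma_i$ neighbours at distance $i-1$ from $x$. A code is a set $C$ of vertices of a regular graph; $C_i$ is the set of vertices at distance exactly $i$ from $C$; the covering radius $\rho$ is the largest $i$ with $C_i\neq\emptyset$, and $\{C_0,\dots,C_\rho\}$ is the distance partition. $C$ is completely regular if there are numbers $\alpha_i,\beta_i,\gamma_i$ such that every vertex of $C_i$ has exactly $\alpha_i$, $\beta_i$, $\gamma_i$ neighbours in $C_i$, $C_{i+1}$, $C_{i-1}$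 respectively; its intersection array is $\{\beta_0,\dots,\beta_{\rho-1};\gamma_1,\dots,\gamma_\rho\}$. Its intersection matrix is the $(\rho+1)\times(\rho+1)$ tridiagonal matrix with diagonal entries $\alpha_0,\dots,\alpha_\rho$, superdiagonal $\beta_0,\dots,\beta_{\rho-1}$ and subdiagonal $\gamma_1,\dots,\gamma_\rho$; $Spec(C)$ is the set of eigenvalues of this matrix. -}

module Defs where

open import Data.Nat as ℕ using (ℕ; zero; suc; _<_; _≤_)
open import Data.Integer using (+_)
open import Data.Rational as ℚ using (ℚ; 0ℚ; 1ℚ)
open import Data.Fin using (Fin; zero; suc; toℕ)
open import Data.Fin.Subset using (Subset; _∈_)
open import Data.Bool using (Bool; true; false; if_then_else_)
open import Data.List using (List; length)
open import Data.List.Relation.Unary.Unique.Propositional using (Unique)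
import Data.List.Membership.Propositional as LM
open import Data.Vec using (Vec; []; _∷_)
open import Data.Product using (Σ; _×_; ∃; ∃-syntax; _,_)
open import Function.Bundles using (_⇔_)
open import Relation.Binary.PropositionalEquality using (_≡_; _≢_)
open import Relation.Nullary using (¬_; yes; no)

record Graph (n : ℕ) : Set where
  field
    adj    : Fin n → Fin n → Bool
    sym    : ∀ x y → adj x y ≡ adj y x
    irrefl : ∀ x → adj x x ≡ false
open Graph public

Adj : ∀ {n} → Graph n → Fin n → Fin n → Set
Adj G x y = adj G x y ≡ true

data Walk {n} (G : Graph n) : ℕ → Fin n → Fin n → Set where
  here : ∀ {x} → Walk G zero x x
  step : ∀ {i x y z} → Adj G x y → Walk G i y z → Walk G (suc i) x z

Dist : ∀ {n} → Graph n → Fin n → Fin n → ℕ → Set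
Dist G x y i = Walk G i x y × (∀ j → j < i → ¬ Walk G j x y)

Card : ∀ {n} → (Fin n → Set) → ℕ → Set
Card {n} P m = Σ (List (Fin n)) λ l →
  length l ≡ m × Unique l × (∀ z → (z LM.∈ l) ⇔ P z)

-- read a vector as a sequence, 0 outside its range
at : ∀ {m} → Vec ℕ m → ℕ → ℕ
at []       _       = 0
at (a ∷ as) zero    = a
at (a ∷ as) (suc i) = at as i

Regular : ∀ {n} → Graph n → ℕ → Set
Regular G k = ∀ x → Card (Adj G x) k

-- Γ is distance-regular of diameter d with intersection array
-- {b_0,...,b_{d-1}; c_1,...,c_d}, given as b = (b_0..b_{d-1}), c = (c_1..c_d)
record IsDRG {n} (G : Graph n) (d : ℕ) (b c : Vec ℕ d) : Set where
  field
    connected : ∀ x y → ∃[ i ] Dist G x y i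
    diam-ub   : ∀ x y i → Dist G x y i → i ≤ d
    diam-att  : ∃[ x ] ∃[ y ] Dist G x y d
    b-count   : ∀ x y i → i < d → Dist G x y i →
                Card (λ z → Adj G y z × Dist G x z (suc i)) (at b i)
    c-count   : ∀ x y i → i < d → Dist G x y (suc i) →
                Card (λ z → Adj G y z × Dist G x z i) (at c i)

ℕ→ℚ : ℕ → ℚ
ℕ→ℚ m = + m ℚ./ 1

Σℚ : ∀ {n} → (Fin n → ℚ) → ℚ
Σℚ {zero}  f = 0ℚ
Σℚ {suc n} f = f zero ℚ.+ Σℚ (λ i → f (suc i))

IsEigenvalue : ∀ {m} → (Fin m → Fin m → ℚ) → ℚ → Set
IsEigenvalue {m} M θ = Σ (Fin m → ℚ) λ v →
  (∃[ i ] v i ≢ 0ℚ) × (∀ i → Σℚ (λ j → M i j ℚ.* v j) ≡ θ ℚ.* v i)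

AdjMat : ∀ {n} → Graph n → Fin n → Fin n → ℚ
AdjMat G x y = if adj G x y then 1ℚ else 0ℚ

-- θ is the minimum eigenvalue of the (real symmetric) matrix M:
-- it is an eigenvalue and M - θI is positive semidefinite
-- (quadratic form tested on rational vectors)
IsMinEigenvalue : ∀ {m} → (Fin m → Fin m → ℚ) → ℚ → Set
IsMinEigenvalue {m} M θ = IsEigenvalue M θ ×
  (∀ (v : Fin m → ℚ) →
     θ ℚ.* Σℚ (λ i → v i ℚ.* v i) ℚ.≤ Σℚ (λ i → v i ℚ.* Σℚ (λ j → M i j ℚ.* v j)))

IsClique : ∀ {n} → Graph n → Subset n → Set
IsClique G K = ∀ x y → x ∈ K → y ∈ K → x ≢ y → Adj G x y

-- |K| = 1 - k/θ, written multiplied out as |K|·θ = θ - k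
IsDelsarteClique : ∀ {n} → Graph n → ℕ → ℚ → Subset n → Set
IsDelsarteClique G k θ K =
  IsClique G K × Σ ℕ λ s → Card (λ x → x ∈ K) s × (ℕ→ℚ s ℚ.* θ ≡ θ ℚ.- ℕ→ℚ k)

IsGeometric : ∀ {n} → Graph n → ℕ → ℚ → (Subset n → Set) → Set
IsGeometric {n} G k θ 𝒦 =
  (∀ K → 𝒦 K → IsDelsarteClique G k θ K) ×
  (∀ x y → Adj G x y →
     Σ (Subset n) λ K → 𝒦 K × x ∈ K × y ∈ K ×
       (∀ K' → 𝒦 K' → x ∈ K' → y ∈ K' → K' ≡ K))

DistC : ∀ {n} → Graph n → Subset n → Fin n → ℕ → Set
DistC G C x i =
  (∃[ c ] c ∈ C × Dist G c x i) × (∀ c j → c ∈ C → Dist G c x j → i ≤ j)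

-- C is completely regular with covering radius ρ, numbers α_0..α_ρ,
-- intersection array {β_0..β_{ρ-1}; γ_1..γ_ρ} (γ stored as (γ_1..γ_ρ))
record IsCompletelyRegular {n} (G : Graph n) (C : Subset n) (ρ : ℕ)
       (α : Vec ℕ (suc ρ)) (β γ : Vec ℕ ρ) : Set where
  field
    covers    : ∀ x → ∃[ i ] i ≤ ρ × DistC G C x i
    radius    : ∃[ x ] DistC G C x ρ
    α-count   : ∀ x i → i ≤ ρ → DistC G C x i →
                Card (λ z → Adj G x z × DistC G C z i) (at α i)
    β-count   : ∀ x i → i < ρ → DistC G C x i →
                Card (λ z → Adj G x z × DistC G C z (suc i)) (at β i)
    γ-count   : ∀ x i → i < ρ → DistC G C x (suc i) →
                Card (λ z → Adj G x z × DistC G C z i) (at γ i)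

-- intersection matrix (tridiagonal): diagonal α_i, superdiagonal β_i,
-- subdiagonal entry in row i+1 is γ_{i+1} (= at γ i)
entry : ∀ {ρ} → Vec ℕ (suc ρ) → Vec ℕ ρ → Vec ℕ ρ → ℕ → ℕ → ℕ
entry α β γ i j with i ℕ.≟ j
... | yes _ = at α i
... | no _ with suc i ℕ.≟ j
...   | yes _ = at β i
...   | no _ with i ℕ.≟ suc j
...     | yes _ = at γ j
...     | no _ = 0

IntersectionMatrix : ∀ {ρ} → Vec ℕ (suc ρ) → Vec ℕ ρ → Vec ℕ ρ →
                     Fin (suc ρ) → Fin (suc ρ) → ℚ
IntersectionMatrix α β γ i j = ℕ→ℚ (entry α β γ (toℕ i) (toℕ j))

InSpec : ∀ {ρ} → ℚ → Vec ℕ (suc ρ) → Vec ℕ ρ → Vec ℕ ρ → Set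
InSpec θ α β γ = IsEigenvalue (IntersectionMatrix α β γ) θ

{-# OPTIONS --safe #-}
module Submission where

-- Let θ be the smallest eigenvalue of Γ and σ = 1 - k/θ the common size of the cliques in 𝒦. For a
-- θ-eigenvector f let S(x, y) be the sum of f over the clique of 𝒦 through the edge xy. The cliques
-- through x cover its k neighbours, each σ - 1 times, so Σ_{y ~ x} S(x, y) = (k + (σ - 1) θ) f(x) = 0,
-- and exchanging sums reduces Σ_{x ~ y} S(x, y)² to such sums: f sums to zero on every clique of 𝒦.
-- If θ ∈ Spec(C), the eigenvector v of the intersection matrix (v_0 = 1, given by the three-term
-- recurrence) lifts to the θ-eigenvector f(x) = v_{d(x,C)}. A clique K ⊆ C_i ∪ C_{i+1} with m vertices
-- in C_i then satisfies m v_i + (σ - m) v_{i+1} = 0, so m = σ v_{i+1} / (v_{i+1} - v_i); the denominator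
-- is nonzero since v has no two consecutive zeros. To express σ through the intersection arrays alone:
-- θ = -k/j with j = σ - 1 ∈ [1, k], and θ is the least such candidate that is a root of the
-- characteristic polynomial of the intersection matrix, because every such root is an eigenvalue of Γ.
-- Finally a_i ≠ 0, as the clique through an edge between C_i and C_{i+1} lies in C_i ∪ C_{i+1}.

open import Defs hiding (sym)
open import Level using (0ℓ)
open import Data.Bool as Bool using (true; false; if_then_else_)
open import Data.Empty using (⊥; ⊥-elim)
open import Data.Fin using (Fin; zero; suc; toℕ; fromℕ<)
open import Data.Fin.Properties as Fin using (_≟_)
open import Data.Fin.Subset as Subset using (Subset; _∈_)
open import Data.Fin.Subset.Properties using (_∈?_)
import Data.Integer as ℤ
import Data.Integer.Properties as ℤ
open import Data.List using (List; []; _∷_; length; filter; allFin)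
open import Data.List.Relation.Unary.Any using (here; there; any?)
open import Data.List.Relation.Unary.All as All using ()
open import Data.List.Relation.Unary.All.Properties using (All¬⇒¬Any)
open import Data.List.Relation.Unary.AllPairs using ([]; _∷_)
open import Data.List.Relation.Unary.Unique.Propositional using (Unique)
import Data.List.Relation.Unary.Unique.Propositional.Properties as Unique
import Data.List.Membership.Propositional as List
import Data.List.Membership.Propositional.Properties as List
open import Data.Maybe as Maybe using ()
open import Data.Nat as ℕ using (ℕ; zero; suc; pred; z≤n; s≤s; _<_)
import Data.Nat.Properties as ℕ
open import Data.Product using (Σ; _×_; ∃-syntax; _,_; proj₁; proj₂)
open import Data.Rational as ℚ using (ℚ; 0ℚ; 1ℚ; _+_; _*_; _-_; -_; _≤_)
open import Data.Rational.Properties hiding (_≟_)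
open import Data.Rational.Properties using () renaming (_≟_ to _≟ℚ_)
import Data.Rational.Unnormalised as ℚᵘ
import Data.Rational.Unnormalised.Properties as ℚᵘ
open import Data.Sum using (_⊎_; inj₁; inj₂)
open import Data.Vec using (Vec; []; _∷_)
open import Function.Bundles using (mk⇔; Equivalence)
open import Relation.Binary.PropositionalEquality
open import Relation.Nullary using (Dec; yes; no; ¬_)
open import Relation.Nullary.Decidable.Core using (dec⇒maybe; map′; _×-dec_)
open import Relation.Unary using (Decidable)
open import Algebra.Bundles using (Ring)
open import Algebra.Properties.Semiring.Sum (Ring.semiring +-*-ring)
  using (sum; sum-cong-≗; sum-replicate-zero; ∑-distrib-+; ∑-comm; *-distribˡ-sum; *-distribʳ-sum)
open import Tactic.RingSolver using (solve-∀)
open import Tactic.RingSolver.Core.AlmostCommutativeRing using (AlmostCommutativeRing; fromCommutativeRing)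

ℚ-ring : AlmostCommutativeRing 0ℓ 0ℓ
ℚ-ring = fromCommutativeRing +-*-commutativeRing (λ x → Maybe.map sym (dec⇒maybe (x ≟ℚ 0ℚ)))

-- A total inverse, with the junk value 0ℚ ⁻¹ = 0ℚ.
_⁻¹ : ℚ → ℚ
q ⁻¹ with q ≟ℚ 0ℚ
... | yes _   = 0ℚ
... | no q≢0 = ℚ.1/_ q {{ℚ.≢-nonZero q≢0}}

⁻¹-inverseʳ : ∀ {q} → q ≢ 0ℚ → q * q ⁻¹ ≡ 1ℚ
⁻¹-inverseʳ {q} q≢0 with q ≟ℚ 0ℚ
... | yes q≡0  = ⊥-elim (q≢0 q≡0)
... | no q≢0′ = *-inverseʳ q {{ℚ.≢-nonZero q≢0′}}

⁻¹-cancelˡ : ∀ {q} x → q ≢ 0ℚ → q ⁻¹ * (q * x) ≡ x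
⁻¹-cancelˡ {q} x q≢0 = begin
  q ⁻¹ * (q * x)  ≡⟨ *-assoc (q ⁻¹) q x ⟨
  q ⁻¹ * q * x    ≡⟨ cong (_* x) (trans (*-comm (q ⁻¹) q) (⁻¹-inverseʳ q≢0)) ⟩
  1ℚ * x          ≡⟨ *-identityˡ x ⟩
  x               ∎
  where open ≡-Reasoning

*-cancelˡ-≢0 : ∀ {q x y} → q ≢ 0ℚ → q * x ≡ q * y → x ≡ y
*-cancelˡ-≢0 {q} {x} {y} q≢0 qx≡qy =
  trans (sym (⁻¹-cancelˡ x q≢0)) (trans (cong (q ⁻¹ *_) qx≡qy) (⁻¹-cancelˡ y q≢0))

*-cancelʳ-≢0 : ∀ {q x y} → q ≢ 0ℚ → x * q ≡ y * q → x ≡ y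
*-cancelʳ-≢0 {q} {x} {y} q≢0 xq≡yq = *-cancelˡ-≢0 q≢0 (trans (*-comm q x) (trans xq≡yq (*-comm y q)))

*≡0⇒≡0 : ∀ {q x} → q ≢ 0ℚ → q * x ≡ 0ℚ → x ≡ 0ℚ
*≡0⇒≡0 {q} q≢0 qx≡0 = *-cancelˡ-≢0 q≢0 (trans qx≡0 (sym (*-zeroʳ q)))

x*x≡0⇒x≡0 : ∀ {x} → x * x ≡ 0ℚ → x ≡ 0ℚ
x*x≡0⇒x≡0 {x} xx≡0 with x ≟ℚ 0ℚ
... | yes x≡0 = x≡0
... | no x≢0  = *≡0⇒≡0 x≢0 xx≡0

0≤x*x : ∀ x → 0ℚ ≤ x * x
0≤x*x x with ≤-total 0ℚ x
... | inj₁ 0≤x = subst (_≤ x * x) (*-zeroˡ x) (*-monoʳ-≤-nonNeg x {{ℚ.nonNegative 0≤x}} 0≤x)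
... | inj₂ x≤0 = subst (_≤ x * x) (*-zeroˡ x) (*-monoʳ-≤-nonPos x {{ℚ.nonPositive x≤0}} x≤0)

0≤x*y : ∀ {x y} → 0ℚ ≤ x → 0ℚ ≤ y → 0ℚ ≤ x * y
0≤x*y {x} {y} 0≤x 0≤y = subst (_≤ x * y) (*-zeroʳ x) (*-monoˡ-≤-nonNeg x {{ℚ.nonNegative 0≤x}} 0≤y)

x+y≡0⇒x≡0 : ∀ {x y} → 0ℚ ≤ x → 0ℚ ≤ y → x + y ≡ 0ℚ → x ≡ 0ℚ
x+y≡0⇒x≡0 {x} {y} 0≤x 0≤y x+y≡0 =
  ≤-antisym (subst₂ _≤_ (+-identityʳ x) x+y≡0 (+-monoʳ-≤ x 0≤y)) 0≤x

toℚᵘ-ℕ→ℚ : ∀ m → ℚ.toℚᵘ (ℕ→ℚ m) ℚᵘ.≃ ℚᵘ.mkℚᵘ (ℤ.+ m) 0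
toℚᵘ-ℕ→ℚ m = toℚᵘ-fromℚᵘ (ℚᵘ.mkℚᵘ (ℤ.+ m) 0)

ℕ→ℚ-+ : ∀ m n → ℕ→ℚ (m ℕ.+ n) ≡ ℕ→ℚ m + ℕ→ℚ n
ℕ→ℚ-+ m n = toℚᵘ-injective (begin
  ℚ.toℚᵘ (ℕ→ℚ (m ℕ.+ n))                   ≈⟨ toℚᵘ-ℕ→ℚ (m ℕ.+ n) ⟩
  ℚᵘ.mkℚᵘ (ℤ.+ (m ℕ.+ n)) 0                  ≈⟨ ℚᵘ.*≡* cross ⟩
  ℚᵘ.mkℚᵘ (ℤ.+ m) 0 ℚᵘ.+ ℚᵘ.mkℚᵘ (ℤ.+ n) 0       ≈⟨ ℚᵘ.+-cong (toℚᵘ-ℕ→ℚ m) (toℚᵘ-ℕ→ℚ n) ⟨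
  ℚ.toℚᵘ (ℕ→ℚ m) ℚᵘ.+ ℚ.toℚᵘ (ℕ→ℚ n)        ≈⟨ toℚᵘ-homo-+ (ℕ→ℚ m) (ℕ→ℚ n) ⟨
  ℚ.toℚᵘ (ℕ→ℚ m + ℕ→ℚ n)                   ∎)
  where
  open ℚᵘ.≃-Reasoning
  cross : ℤ.+ (m ℕ.+ n) ℤ.* ℤ.1ℤ ≡ ((ℤ.+ m) ℤ.* ℤ.1ℤ ℤ.+ (ℤ.+ n) ℤ.* ℤ.1ℤ) ℤ.* ℤ.1ℤ
  cross = trans (ℤ.*-identityʳ _) (trans (ℤ.pos-+ m n) (sym (trans (ℤ.*-identityʳ _)
            (cong₂ ℤ._+_ (ℤ.*-identityʳ (ℤ.+ m)) (ℤ.*-identityʳ (ℤ.+ n))))))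

ℕ→ℚ-suc : ∀ m → ℕ→ℚ (suc m) ≡ 1ℚ + ℕ→ℚ m
ℕ→ℚ-suc = ℕ→ℚ-+ 1

ℕ→ℚ-mono-≤ : ∀ {m n} → m ℕ.≤ n → ℕ→ℚ m ≤ ℕ→ℚ n
ℕ→ℚ-mono-≤ {m} {n} m≤n = toℚᵘ-cancel-≤
  (ℚᵘ.≤-respˡ-≃ (ℚᵘ.≃-sym (toℚᵘ-ℕ→ℚ m)) (ℚᵘ.≤-respʳ-≃ (ℚᵘ.≃-sym (toℚᵘ-ℕ→ℚ n))
    (ℚᵘ.*≤* (ℤ.*-monoʳ-≤-nonNeg (ℤ.+ 1) (ℤ.+≤+ m≤n)))))

ℕ→ℚ-cancel-≤ : ∀ {m n} → ℕ→ℚ m ≤ ℕ→ℚ n → m ℕ.≤ n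
ℕ→ℚ-cancel-≤ {m} {n} m≤n = ℤ.drop‿+≤+ (ℤ.*-cancelʳ-≤-pos (ℤ.+ m) (ℤ.+ n) (ℤ.+ 1) (ℚᵘ.drop-*≤*
  (ℚᵘ.≤-respˡ-≃ (toℚᵘ-ℕ→ℚ m) (ℚᵘ.≤-respʳ-≃ (toℚᵘ-ℕ→ℚ n) (toℚᵘ-mono-≤ m≤n)))))

ℕ→ℚ-injective : ∀ {m n} → ℕ→ℚ m ≡ ℕ→ℚ n → m ≡ n
ℕ→ℚ-injective m≡n = ℕ.≤-antisym (ℕ→ℚ-cancel-≤ (≤-reflexive m≡n)) (ℕ→ℚ-cancel-≤ (≤-reflexive (sym m≡n)))

ℕ→ℚ-nonNeg : ∀ m → 0ℚ ≤ ℕ→ℚ m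
ℕ→ℚ-nonNeg m = nonNegative⁻¹ (ℕ→ℚ m) {{normalize-nonNeg m 1}}

ℕ→ℚ-≢0 : ∀ {m} → 1 ℕ.≤ m → ℕ→ℚ m ≢ 0ℚ
ℕ→ℚ-≢0 {m} 1≤m m≡0 = ℕ.<⇒≢ 1≤m (sym (ℕ→ℚ-injective {m} {0} m≡0))

ℕ→ℚ-pos : ∀ m → 0ℚ ℚ.< ℕ→ℚ (suc m)
ℕ→ℚ-pos m = positive⁻¹ (ℕ→ℚ (suc m)) {{normalize-pos (suc m) 1}}

Σℚ≡sum : ∀ {n} (f : Fin n → ℚ) → Σℚ f ≡ sum f
Σℚ≡sum {zero}  f = refl
Σℚ≡sum {suc n} f = cong (f zero +_) (Σℚ≡sum (λ i → f (suc i)))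

sum-zero : ∀ n → sum {n} (λ _ → 0ℚ) ≡ 0ℚ
sum-zero = sum-replicate-zero

sum-*ˡ : ∀ {n} c (f : Fin n → ℚ) → sum (λ i → c * f i) ≡ c * sum f
sum-*ˡ c f = sym (*-distribˡ-sum c f)

sum-*ʳ : ∀ {n} c (f : Fin n → ℚ) → sum (λ i → f i * c) ≡ sum f * c
sum-*ʳ c f = sym (*-distribʳ-sum c f)

sum-distrib-- : ∀ {n} (f g : Fin n → ℚ) → sum (λ i → f i - g i) ≡ sum f - sum g
sum-distrib-- f g = begin
  sum (λ i → f i - g i)                   ≡⟨ x≡x+y-y _ (sum g) ⟩
  sum (λ i → f i - g i) + sum g - sum g   ≡⟨ cong (_- sum g) (∑-distrib-+ (λ i → f i - g i) g) ⟨
  sum (λ i → f i - g i + g i) - sum g     ≡⟨ cong (_- sum g) (sum-cong-≗ (λ i → x-y+y≡x (f i) (g i))) ⟩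
  sum f - sum g                           ∎
  where
  open ≡-Reasoning
  x≡x+y-y : ∀ x y → x ≡ x + y - y
  x≡x+y-y = solve-∀ ℚ-ring
  x-y+y≡x : ∀ x y → x - y + y ≡ x
  x-y+y≡x = solve-∀ ℚ-ring

sum-linear₃ : ∀ {n} (f g h : Fin n → ℚ) a b c →
  sum (λ i → f i * a + g i * b + h i * c) ≡ sum f * a + sum g * b + sum h * c
sum-linear₃ f g h a b c = begin
  sum (λ i → f i * a + g i * b + h i * c)                      ≡⟨ ∑-distrib-+ _ (λ i → h i * c) ⟩
  sum (λ i → f i * a + g i * b) + sum (λ i → h i * c)          ≡⟨ cong (_+ _) (∑-distrib-+ (λ i → f i * a) (λ i → g i * b)) ⟩
  sum (λ i → f i * a) + sum (λ i → g i * b) + sum (λ i → h i * c)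
    ≡⟨ cong₂ _+_ (cong₂ _+_ (sum-*ʳ a f) (sum-*ʳ b g)) (sum-*ʳ c h) ⟩
  sum f * a + sum g * b + sum h * c                            ∎
  where open ≡-Reasoning

sum-nonNeg : ∀ {n} {f : Fin n → ℚ} → (∀ i → 0ℚ ≤ f i) → 0ℚ ≤ sum f
sum-nonNeg {zero}  0≤f = ≤-refl
sum-nonNeg {suc n} 0≤f = +-mono-≤ (0≤f zero) (sum-nonNeg (λ i → 0≤f (suc i)))

sum-mono-≤ : ∀ {n} {f g : Fin n → ℚ} → (∀ i → f i ≤ g i) → sum f ≤ sum g
sum-mono-≤ {zero}  f≤g = ≤-refl
sum-mono-≤ {suc n} f≤g = +-mono-≤ (f≤g zero) (sum-mono-≤ (λ i → f≤g (suc i)))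

sum≡0⇒≡0 : ∀ {n} {f : Fin n → ℚ} → (∀ i → 0ℚ ≤ f i) → sum f ≡ 0ℚ → ∀ i → f i ≡ 0ℚ
sum≡0⇒≡0 {suc n} {f} 0≤f Σ≡0 zero    = x+y≡0⇒x≡0 (0≤f zero) (sum-nonNeg (λ i → 0≤f (suc i))) Σ≡0
sum≡0⇒≡0 {suc n} {f} 0≤f Σ≡0 (suc i) = sum≡0⇒≡0 (λ i → 0≤f (suc i))
  (x+y≡0⇒x≡0 (sum-nonNeg (λ i → 0≤f (suc i))) (0≤f zero) (trans (+-comm _ (f zero)) Σ≡0)) i

𝟙 : ∀ {A : Set} → Dec A → ℚ
𝟙 (yes _) = 1ℚ
𝟙 (no _)  = 0ℚ

𝟙-yes : ∀ {A : Set} (a? : Dec A) → A → 𝟙 a? ≡ 1ℚ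
𝟙-yes (yes _) _ = refl
𝟙-yes (no ¬a) a = ⊥-elim (¬a a)

𝟙-no : ∀ {A : Set} (a? : Dec A) → ¬ A → 𝟙 a? ≡ 0ℚ
𝟙-no (yes a) ¬a = ⊥-elim (¬a a)
𝟙-no (no _)  _  = refl

𝟙-cong : ∀ {A B : Set} (a? : Dec A) (b? : Dec B) → (A → B) → (B → A) → 𝟙 a? ≡ 𝟙 b?
𝟙-cong (yes a) b? f g = sym (𝟙-yes b? (f a))
𝟙-cong (no ¬a) b? f g = sym (𝟙-no b? (λ b → ¬a (g b)))

δ : ∀ {n} → Fin n → Fin n → ℚ
δ x y = 𝟙 (x ≟ y)

sum-δ : ∀ {n} (x : Fin n) (g : Fin n → ℚ) → sum (λ y → δ x y * g y) ≡ g x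
sum-δ {suc n} zero g = begin
  1ℚ * g zero + sum (λ y → 0ℚ * g (suc y))  ≡⟨ cong₂ _+_ (*-identityˡ (g zero)) (zeros (λ y → g (suc y))) ⟩
  g zero + 0ℚ                                ≡⟨ +-identityʳ (g zero) ⟩
  g zero                                     ∎
  where
  open ≡-Reasoning
  zeros : ∀ {m} (h : Fin m → ℚ) → sum (λ y → 0ℚ * h y) ≡ 0ℚ
  zeros h = trans (sum-*ˡ 0ℚ h) (*-zeroˡ (sum h))
sum-δ {suc n} (suc x) g = begin
  0ℚ * g zero + sum (λ y → δ (suc x) (suc y) * g (suc y))  ≡⟨ cong₂ _+_ (*-zeroˡ (g zero)) (sum-cong-≗ δ-suc) ⟩
  0ℚ + sum (λ y → δ x y * g (suc y))                       ≡⟨ +-identityˡ _ ⟩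
  sum (λ y → δ x y * g (suc y))                            ≡⟨ sum-δ x (λ y → g (suc y)) ⟩
  g (suc x)                                                ∎
  where
  open ≡-Reasoning
  δ-suc : ∀ y → δ (suc x) (suc y) * g (suc y) ≡ δ x y * g (suc y)
  δ-suc y = cong (_* g (suc y)) (𝟙-cong (suc x ≟ suc y) (x ≟ y) Fin.suc-injective (cong suc))

sum-δ-1 : ∀ {n} (x : Fin n) → sum (δ x) ≡ 1ℚ
sum-δ-1 x = trans (sum-cong-≗ (λ y → sym (*-identityʳ (δ x y)))) (sum-δ x (λ _ → 1ℚ))

_∈ₗ?_ : ∀ {n} (y : Fin n) (l : List (Fin n)) → Dec (y List.∈ l)
y ∈ₗ? l = any? (y ≟_) l

sum-∈-unique : ∀ {n} {l : List (Fin n)} → Unique l → sum (λ y → 𝟙 (y ∈ₗ? l)) ≡ ℕ→ℚ (length l)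
sum-∈-unique {n} {[]}    []          = sum-zero n
sum-∈-unique {n} {x ∷ l} (x∉l ∷ l!) = begin
  sum (λ y → 𝟙 (y ∈ₗ? (x ∷ l)))        ≡⟨ sum-cong-≗ split ⟩
  sum (λ y → δ x y + 𝟙 (y ∈ₗ? l))       ≡⟨ ∑-distrib-+ (δ x) _ ⟩
  sum (δ x) + sum (λ y → 𝟙 (y ∈ₗ? l))   ≡⟨ cong₂ _+_ (sum-δ-1 x) (sum-∈-unique l!) ⟩
  1ℚ + ℕ→ℚ (length l)                  ≡⟨ ℕ→ℚ-suc (length l) ⟨
  ℕ→ℚ (length (x ∷ l))                 ∎
  where
  open ≡-Reasoning
  split : ∀ y → 𝟙 (y ∈ₗ? (x ∷ l)) ≡ δ x y + 𝟙 (y ∈ₗ? l)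
  split y with x ≟ y
  ... | yes refl = begin
    𝟙 (x ∈ₗ? (x ∷ l))     ≡⟨ 𝟙-yes (x ∈ₗ? (x ∷ l)) (here refl) ⟩
    1ℚ                   ≡⟨ +-identityʳ 1ℚ ⟨
    1ℚ + 0ℚ              ≡⟨ cong (1ℚ +_) (𝟙-no (x ∈ₗ? l) (All¬⇒¬Any x∉l)) ⟨
    1ℚ + 𝟙 (x ∈ₗ? l)      ∎
  ... | no x≢y = begin
    𝟙 (y ∈ₗ? (x ∷ l))     ≡⟨ 𝟙-cong (y ∈ₗ? (x ∷ l)) (y ∈ₗ? l) (λ { (here y≡x) → ⊥-elim (x≢y (sym y≡x)) ; (there y∈l) → y∈l })
                                   there ⟩
    𝟙 (y ∈ₗ? l)           ≡⟨ +-identityˡ _ ⟨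
    0ℚ + 𝟙 (y ∈ₗ? l)      ∎

sum-indicator : ∀ {n} {P : Fin n → Set} {m} (χ : Fin n → ℚ) → Card P m →
  (∀ y → P y → χ y ≡ 1ℚ) → (∀ y → ¬ P y → χ y ≡ 0ℚ) → sum χ ≡ ℕ→ℚ m
sum-indicator χ (l , refl , l! , l⇔P) χ-yes χ-no = trans (sum-cong-≗ χ≗𝟙) (sum-∈-unique l!)
  where
  χ≗𝟙 : ∀ y → χ y ≡ 𝟙 (y ∈ₗ? l)
  χ≗𝟙 y with y ∈ₗ? l
  ... | yes y∈l = χ-yes y (Equivalence.to (l⇔P y) y∈l)
  ... | no y∉l  = χ-no y (λ Py → y∉l (Equivalence.from (l⇔P y) Py))

Card-filter : ∀ {n} {P : Fin n → Set} (P? : Decidable P) → Card P (length (filter P? (allFin n)))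
Card-filter {n} P? = filter P? (allFin n) , refl , Unique.filter⁺ P? {allFin n} (Unique.allFin⁺ n) ,
  λ z → mk⇔ (λ z∈ → proj₂ (List.∈-filter⁻ P? {xs = allFin n} z∈)) (List.∈-filter⁺ P? (List.∈-allFin z))

Card-nonempty : ∀ {n} {P : Fin n → Set} {m} → Card P m → ∀ {z} → P z → 1 ℕ.≤ m
Card-nonempty ([]    , refl , _ , l⇔P) Pz with () ← Equivalence.from (l⇔P _) Pz
Card-nonempty (_ ∷ _ , refl , _ , _)   _  = s≤s z≤n

Card-two : ∀ {n} {P : Fin n → Set} {m} → Card P m → ∀ {x y} → P x → P y → x ≢ y → 2 ℕ.≤ m
Card-two ([] , refl , _ , l⇔P) Px _ _ with () ← Equivalence.from (l⇔P _) Px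
Card-two (a ∷ [] , refl , _ , l⇔P) {x} {y} Px Py x≢y
  with Equivalence.from (l⇔P x) Px | Equivalence.from (l⇔P y) Py
... | here refl | here refl = ⊥-elim (x≢y refl)
Card-two (a ∷ b ∷ _ , refl , _ , _) _ _ _ = s≤s (s≤s z≤n)

Card-two⁻ : ∀ {n} {P : Fin n → Set} {m} → Card P m → 2 ℕ.≤ m → ∃[ x ] ∃[ y ] (P x × P y × x ≢ y)
Card-two⁻ (a ∷ [] , refl , _ , _) (s≤s ())
Card-two⁻ (a ∷ b ∷ _ , refl , (a∉ ∷ _) , l⇔P) _ =
  a , b , Equivalence.to (l⇔P a) (here refl) , Equivalence.to (l⇔P b) (there (here refl)) , All.head a∉

IsEigenvector : ∀ {m} → (Fin m → Fin m → ℚ) → ℚ → (Fin m → ℚ) → Set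
IsEigenvector M μ f = ∀ x → sum (λ z → M x z * f z) ≡ μ * f x

0<sum-squares : ∀ {m} (f : Fin m → ℚ) {x} → f x ≢ 0ℚ → 0ℚ ℚ.< sum (λ i → f i * f i)
0<sum-squares f {x} fx≢0 with sum (λ i → f i * f i) ≤? 0ℚ
... | no Q≰0 = ≰⇒> Q≰0
... | yes Q≤0 = ⊥-elim (fx≢0 (x*x≡0⇒x≡0 (sum≡0⇒≡0 squares≥0 (≤-antisym Q≤0 (sum-nonNeg squares≥0)) x)))
  where
  squares≥0 : ∀ i → 0ℚ ≤ f i * f i
  squares≥0 i = 0≤x*x (f i)

IsMinEigenvalue⇒≤ : ∀ {m} {M : Fin m → Fin m → ℚ} {θ μ f} → IsMinEigenvalue M θ → IsEigenvector M μ f →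
  ∀ {x} → f x ≢ 0ℚ → θ ≤ μ
IsMinEigenvalue⇒≤ {M = M} {θ} {μ} {f} (_ , psd) eigen fx≢0 =
  *-cancelʳ-≤-pos Q {{ℚ.positive (0<sum-squares f fx≢0)}} (begin
    θ * Q                                      ≡⟨ cong (θ *_) (Σℚ≡sum (λ i → f i * f i)) ⟨
    θ * Σℚ (λ i → f i * f i)                   ≤⟨ psd f ⟩
    Σℚ (λ i → f i * Σℚ (λ j → M i j * f j))    ≡⟨ Σℚ≡sum (λ i → f i * Σℚ (λ j → M i j * f j)) ⟩
    sum (λ i → f i * Σℚ (λ j → M i j * f j))
      ≡⟨ sum-cong-≗ (λ i → cong (f i *_) (trans (Σℚ≡sum (λ j → M i j * f j)) (eigen i))) ⟩
    sum (λ i → f i * (μ * f i))                ≡⟨ sum-cong-≗ (λ i → swap (f i) μ) ⟩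
    sum (λ i → μ * (f i * f i))                ≡⟨ sum-*ˡ μ (λ i → f i * f i) ⟩
    μ * Q                                      ∎)
  where
  open ≤-Reasoning
  Q = sum (λ i → f i * f i)
  swap : ∀ a b → a * (b * a) ≡ b * (a * a)
  swap = solve-∀ ℚ-ring

module _ {n : ℕ} (G : Graph n) where

  Adj-sym : ∀ {x y} → Adj G x y → Adj G y x
  Adj-sym {x} {y} xy = trans (Graph.sym G y x) xy

  Adj-irrefl : ∀ {x y} → Adj G x y → x ≢ y
  Adj-irrefl {x} xx refl with () ← trans (sym xx) (Graph.irrefl G x)

  Adj? : ∀ x y → Dec (Adj G x y)
  Adj? x y = adj G x y Bool.≟ true

  AdjMat-adj : ∀ {x y} → Adj G x y → AdjMat G x y ≡ 1ℚ
  AdjMat-adj xy rewrite xy = refl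

  AdjMat-¬adj : ∀ {x y} → ¬ Adj G x y → AdjMat G x y ≡ 0ℚ
  AdjMat-¬adj {x} {y} ¬xy with adj G x y
  ... | true  = ⊥-elim (¬xy refl)
  ... | false = refl

  AdjMat-sym : ∀ x y → AdjMat G x y ≡ AdjMat G y x
  AdjMat-sym x y = cong (λ e → if e then 1ℚ else 0ℚ) (Graph.sym G x y)

  AdjMat-irrefl : ∀ x → AdjMat G x x ≡ 0ℚ
  AdjMat-irrefl x = cong (λ e → if e then 1ℚ else 0ℚ) (Graph.irrefl G x)

  AdjMat-nonNeg : ∀ x y → 0ℚ ≤ AdjMat G x y
  AdjMat-nonNeg x y with adj G x y
  ... | true  = ℕ→ℚ-nonNeg 1
  ... | false = ≤-refl

  degree : ∀ {k} → Regular G k → ∀ x → sum (AdjMat G x) ≡ ℕ→ℚ k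
  degree reg x = sum-indicator (AdjMat G x) (reg x) (λ _ → AdjMat-adj) (λ _ → AdjMat-¬adj)

  AdjMat-*-cong : ∀ {x z u w} → (Adj G x z → u ≡ w) → AdjMat G x z * u ≡ AdjMat G x z * w
  AdjMat-*-cong {x} {z} {u} {w} u≡w with Adj? x z
  ... | yes xz  = cong (AdjMat G x z *_) (u≡w xz)
  ... | no ¬xz = trans (cong (_* u) (AdjMat-¬adj ¬xz)) (trans (*-zeroˡ u)
                   (sym (trans (cong (_* w) (AdjMat-¬adj ¬xz)) (*-zeroˡ w))))

  Dist-refl : ∀ x → Dist G x x 0
  Dist-refl x = here , λ _ ()

  Dist-adj : ∀ {x y} → Adj G x y → Dist G x y 1
  Dist-adj {x} {y} xy = step xy here , shorter
    where
    shorter : ∀ j → j ℕ.< 1 → ¬ Walk G j x y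
    shorter zero _ here = Adj-irrefl xy refl
    shorter (suc j) (s≤s ()) _

  clique-size≤1+k : ∀ {k K s x} → Regular G k → IsClique G K → x ∈ K → Card (_∈ K) s → s ℕ.≤ suc k
  clique-size≤1+k {k} {K} {s} {x} reg clq x∈K card = ℕ→ℚ-cancel-≤ (begin
    ℕ→ℚ s                                   ≡⟨ x≡x-1+1 (ℕ→ℚ s) ⟩
    ℕ→ℚ s - 1ℚ + 1ℚ                         ≡⟨ cong (_+ 1ℚ) (cong₂ _-_ size (sum-δ-1 x)) ⟨
    sum 𝟙K - sum (δ x) + 1ℚ                 ≡⟨ cong (_+ 1ℚ) (sum-distrib-- 𝟙K (δ x)) ⟨
    sum (λ z → 𝟙K z - δ x z) + 1ℚ           ≤⟨ +-monoˡ-≤ 1ℚ (sum-mono-≤ others≤neighbours) ⟩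
    sum (AdjMat G x) + 1ℚ                   ≡⟨ cong (_+ 1ℚ) (degree reg x) ⟩
    ℕ→ℚ k + 1ℚ                              ≡⟨ trans (+-comm (ℕ→ℚ k) 1ℚ) (sym (ℕ→ℚ-suc k)) ⟩
    ℕ→ℚ (suc k)                             ∎)
    where
    open ≤-Reasoning
    𝟙K : Fin n → ℚ
    𝟙K z = 𝟙 (z ∈? K)
    size : sum 𝟙K ≡ ℕ→ℚ s
    size = sum-indicator 𝟙K card (λ z → 𝟙-yes (z ∈? K)) (λ z → 𝟙-no (z ∈? K))
    x≡x-1+1 : ∀ x → x ≡ x - 1ℚ + 1ℚ
    x≡x-1+1 = solve-∀ ℚ-ring
    others≤neighbours : ∀ z → 𝟙K z - δ x z ≤ AdjMat G x z
    others≤neighbours z with x ≟ z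
    ... | yes refl = subst (_≤ AdjMat G x x) (sym (trans (cong (_- 1ℚ) (𝟙-yes (x ∈? K) x∈K)) (+-inverseʳ 1ℚ))) (AdjMat-nonNeg x x)
    ... | no x≢z with z ∈? K
    ...   | yes z∈K = ≤-reflexive (sym (AdjMat-adj (clq x z x∈K z∈K x≢z)))
    ...   | no _    = AdjMat-nonNeg x z

  delsarte-clique-size : ∀ {k θ K} → IsDelsarteClique G k θ K → ∀ {x y} → x ∈ K → y ∈ K → x ≢ y →
    ∃[ j ] (1 ℕ.≤ j × Card (_∈ K) (suc j) × ℕ→ℚ j * θ ≡ - ℕ→ℚ k)
  delsarte-clique-size {k} {θ} {K} (_ , s , card , sθ≡θ-k) x∈K y∈K x≢y = shape s card sθ≡θ-k (Card-two card x∈K y∈K x≢y)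
    where
    shape : ∀ s → Card (_∈ K) s → ℕ→ℚ s * θ ≡ θ - ℕ→ℚ k → 2 ℕ.≤ s →
      ∃[ j ] (1 ℕ.≤ j × Card (_∈ K) (suc j) × ℕ→ℚ j * θ ≡ - ℕ→ℚ k)
    shape (suc j) card sθ≡θ-k (s≤s 1≤j) = j , 1≤j , card , (begin
      ℕ→ℚ j * θ                      ≡⟨ peel (ℕ→ℚ j) θ ⟩
      (1ℚ + ℕ→ℚ j) * θ - θ           ≡⟨ cong (λ s → s * θ - θ) (ℕ→ℚ-suc j) ⟨
      ℕ→ℚ (suc j) * θ - θ            ≡⟨ cong (_- θ) sθ≡θ-k ⟩
      θ - ℕ→ℚ k - θ                  ≡⟨ cancel θ (ℕ→ℚ k) ⟩
      - ℕ→ℚ k                        ∎)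
      where
      open ≡-Reasoning
      peel : ∀ j t → j * t ≡ (1ℚ + j) * t - t
      peel = solve-∀ ℚ-ring
      cancel : ∀ t k → t - k - t ≡ - k
      cancel = solve-∀ ℚ-ring

  valency≡b₀ : ∀ {d b c k} → IsDRG G d b c → Regular G k → ∀ {x y} → Adj G x y → at b 0 ≡ k
  valency≡b₀ {b = b} {k = k} drg reg {x} xy = ℕ→ℚ-injective (begin
    ℕ→ℚ (at b 0)        ≡⟨ sum-indicator (AdjMat G x) neighbours (λ _ (xz , _) → AdjMat-adj xz)
                                           (λ _ ¬P → AdjMat-¬adj (λ xz → ¬P (xz , Dist-adj xz))) ⟨
    sum (AdjMat G x)    ≡⟨ degree reg x ⟩
    ℕ→ℚ k               ∎)
    where
    open ≡-Reasoning
    neighbours : Card (λ z → Adj G x z × Dist G x z 1) (at b 0)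
    neighbours = IsDRG.b-count drg x x 0 (IsDRG.diam-ub drg x _ 1 (Dist-adj xy)) (Dist-refl x)

  walk-snoc : ∀ {i x y z} → Walk G i x y → Adj G y z → Walk G (suc i) x z
  walk-snoc here       yz = step yz here
  walk-snoc (step a w) yz = step a (walk-snoc w yz)

  walk-unsnoc : ∀ {i x z} → Walk G (suc i) x z → ∃[ y ] (Walk G i x y × Adj G y z)
  walk-unsnoc (step xz here)       = _ , here , xz
  walk-unsnoc (step xy (step a w)) with walk-unsnoc (step a w)
  ... | y , w′ , yz = y , step xy w′ , yz

  module DistanceToCode (connected : ∀ x y → ∃[ i ] Dist G x y i) (C : Subset n) where

    walk⇒Dist≤ : ∀ {l x y} → Walk G l x y → ∃[ m ] (m ℕ.≤ l × Dist G x y m)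
    walk⇒Dist≤ {l} {x} {y} w with connected x y
    ... | m , d with m ℕ.≤? l
    ...   | yes m≤l = m , m≤l , d
    ...   | no m≰l  = ⊥-elim (proj₂ d l (ℕ.≰⇒> m≰l) w)

    DistC-unique : ∀ {x i j} → DistC G C x i → DistC G C x j → i ≡ j
    DistC-unique ((c , c∈C , d) , i-min) ((c′ , c′∈C , d′) , j-min) =
      ℕ.≤-antisym (i-min c′ _ c′∈C d′) (j-min c _ c∈C d)

    DistC-adj : ∀ {x y i j} → Adj G x y → DistC G C x i → DistC G C y j → j ℕ.≤ suc i
    DistC-adj xy ((c , c∈C , w , _) , _) (_ , j-min) with walk⇒Dist≤ (walk-snoc w xy)
    ... | m , m≤1+i , d = ℕ.≤-trans (j-min c m c∈C d) m≤1+i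

    DistC-down : ∀ {y j} → DistC G C y (suc j) → ∃[ x ] (Adj G y x × DistC G C x j)
    DistC-down {y} {j} ((c , c∈C , w , shortest) , j-min) with walk-unsnoc w
    ... | x , w′ , xy = x , Adj-sym xy , (c , c∈C , w′ , shortest′) , j-min′
      where
      shortest′ : ∀ l → l ℕ.< j → ¬ Walk G l c x
      shortest′ l l<j w″ = shortest (suc l) (s≤s l<j) (walk-snoc w″ xy)
      j-min′ : ∀ c′ l → c′ ∈ C → Dist G c′ x l → j ℕ.≤ l
      j-min′ c′ l c′∈C (w″ , _) with walk⇒Dist≤ (walk-snoc w″ xy)
      ... | m , m≤1+l , d = ℕ.≤-pred (ℕ.≤-trans (j-min c′ m c′∈C d) m≤1+l)

    DistC-descend : ∀ t {y j} → DistC G C y (t ℕ.+ j) → ∃[ x ] DistC G C x j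
    DistC-descend zero    dy = _ , dy
    DistC-descend (suc t) dy = DistC-descend t (proj₂ (proj₂ (DistC-down dy)))

    DistC-below : ∀ {x ρ} → DistC G C x ρ → ∀ j → j ℕ.≤ ρ → ∃[ y ] DistC G C y j
    DistC-below {x} {ρ} dx j j≤ρ = DistC-descend (ρ ℕ.∸ j) (subst (DistC G C x) (sym (ℕ.m∸n+n≡m j≤ρ)) dx)

-- Completely regular codes

at-≥ : ∀ {m} (v : Vec ℕ m) {i} → m ℕ.≤ i → at v i ≡ 0
at-≥ []      _         = refl
at-≥ (_ ∷ v) (s≤s m≤i) = at-≥ v m≤i

module IntersectionNumbers {ρ} (β γ : Vec ℕ ρ) where

  β[_] : ℕ → ℚ
  β[ j ] = ℕ→ℚ (at β j)

  -- γ[ j ] is γ_j of the paper; γ_0 = 0 is not stored in the vector γ.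
  γ[_] : ℕ → ℚ
  γ[ zero ]  = 0ℚ
  γ[ suc j ] = ℕ→ℚ (at γ j)

  β[ρ]≡0 : β[ ρ ] ≡ 0ℚ
  β[ρ]≡0 = cong ℕ→ℚ (at-≥ β ℕ.≤-refl)

  Row : (ℕ → ℚ) → ℚ → (ℕ → ℚ) → ℕ → Set
  Row α θ v j = α j * v j + β[ j ] * v (suc j) + γ[ j ] * v (pred j) ≡ θ * v j

  Eigensequence : (ℕ → ℚ) → ℚ → (ℕ → ℚ) → Set
  Eigensequence α θ v = ∀ j → j ℕ.≤ ρ → Row α θ v j

  Eigensequence-cong : ∀ {α α′ θ v} → (∀ j → j ℕ.≤ ρ → α j ≡ α′ j) →
    Eigensequence α θ v → Eigensequence α′ θ v
  Eigensequence-cong {v = v} α≡α′ rows j j≤ρ =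
    subst (λ a → a * v j + β[ j ] * v (suc j) + γ[ j ] * v (pred j) ≡ _) (α≡α′ j j≤ρ) (rows j j≤ρ)

n≢1+n : ∀ n → n ≢ suc n
n≢1+n n = ℕ.<⇒≢ (ℕ.n<1+n n)

n≢2+n : ∀ n → n ≢ suc (suc n)
n≢2+n n = ℕ.<⇒≢ (ℕ.m<n⇒m<1+n (ℕ.n<1+n n))

coeffs-cong : ∀ {e₁ e₂ e₃ a b c} x y z → e₁ ≡ a → e₂ ≡ b → e₃ ≡ c →
  e₁ * x + e₂ * y + e₃ * z ≡ a * x + b * y + c * z
coeffs-cong x y z e₁≡a e₂≡b e₃≡c = cong₂ _+_ (cong₂ _+_ (cong (_* x) e₁≡a) (cong (_* y) e₂≡b)) (cong (_* z) e₃≡c)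

select₁ : ∀ x y z → x ≡ 1ℚ * x + 0ℚ * y + 0ℚ * z
select₁ = solve-∀ ℚ-ring

select₂ : ∀ x y z → y ≡ 0ℚ * x + 1ℚ * y + 0ℚ * z
select₂ = solve-∀ ℚ-ring

select₃ : ∀ x y z → z ≡ 0ℚ * x + 0ℚ * y + 1ℚ * z
select₃ = solve-∀ ℚ-ring

adjacent-levels : ∀ {i j} → j ℕ.≤ suc i → i ℕ.≤ suc j → j ≡ i ⊎ j ≡ suc i ⊎ suc j ≡ i
adjacent-levels {i} {j} j≤1+i i≤1+j with ℕ.m≤n⇒m<n∨m≡n j≤1+i | ℕ.m≤n⇒m<n∨m≡n i≤1+j
... | inj₂ j≡1+i | _          = inj₂ (inj₁ j≡1+i)
... | inj₁ _     | inj₂ i≡1+j = inj₂ (inj₂ (sym i≡1+j))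
... | inj₁ j<1+i | inj₁ i<1+j = inj₁ (ℕ.≤-antisym (ℕ.≤-pred j<1+i) (ℕ.≤-pred i<1+j))

split-by-level : ∀ (g : ℕ → ℚ) {i j} → j ≡ i ⊎ j ≡ suc i ⊎ suc j ≡ i →
  g j ≡ 𝟙 (j ℕ.≟ i) * g i + 𝟙 (j ℕ.≟ suc i) * g (suc i) + 𝟙 (suc j ℕ.≟ i) * g (pred i)
split-by-level g {i} (inj₁ refl) = trans (select₁ (g i) (g (suc i)) (g (pred i)))
  (sym (coeffs-cong _ _ _ (𝟙-yes (i ℕ.≟ i) refl) (𝟙-no (i ℕ.≟ suc i) (n≢1+n i)) (𝟙-no (suc i ℕ.≟ i) ℕ.1+n≢n)))
split-by-level g {i} (inj₂ (inj₁ refl)) = trans (select₂ (g i) (g (suc i)) (g (pred i)))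
  (sym (coeffs-cong _ _ _ (𝟙-no (suc i ℕ.≟ i) ℕ.1+n≢n) (𝟙-yes (suc i ℕ.≟ suc i) refl) (𝟙-no (suc (suc i) ℕ.≟ i) (≢-sym (n≢2+n i)))))
split-by-level g {.(suc j)} {j} (inj₂ (inj₂ refl)) = trans (select₃ (g (suc j)) (g (suc (suc j))) (g j))
  (sym (coeffs-cong _ _ _ (𝟙-no (j ℕ.≟ suc j) (n≢1+n j)) (𝟙-no (j ℕ.≟ suc (suc j)) (n≢2+n j)) (𝟙-yes (suc j ℕ.≟ suc j) refl)))

module CompletelyRegularCode {n} (G : Graph n) (connected : ∀ x y → ∃[ i ] Dist G x y i)
  {k} (reg : Regular G k) (C : Subset n) {ρ α β γ} (cr : IsCompletelyRegular G C ρ α β γ) where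

  open IsCompletelyRegular cr
  open DistanceToCode G connected C
  open IntersectionNumbers β γ

  A : Fin n → Fin n → ℚ
  A = AdjMat G

  α[_] : ℕ → ℚ
  α[ j ] = ℕ→ℚ (at α j)

  level : Fin n → ℕ
  level x = proj₁ (covers x)

  level≤ρ : ∀ x → level x ℕ.≤ ρ
  level≤ρ x = proj₁ (proj₂ (covers x))

  DistC-level : ∀ x → DistC G C x (level x)
  DistC-level x = proj₂ (proj₂ (covers x))

  level-unique : ∀ {x j} → DistC G C x j → level x ≡ j
  level-unique = DistC-unique (DistC-level _)

  DistC-of-level : ∀ {x j} → level x ≡ j → DistC G C x j
  DistC-of-level {x} refl = DistC-level x

  level-nonempty : ∀ j → j ℕ.≤ ρ → ∃[ x ] DistC G C x j
  level-nonempty = DistC-below (proj₂ radius)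

  edge-between-levels : ∀ j → j ℕ.< ρ → ∃[ x ] ∃[ y ] (DistC G C x j × DistC G C y (suc j) × Adj G x y)
  edge-between-levels j j<ρ with level-nonempty (suc j) j<ρ
  ... | y , dy with DistC-down dy
  ...   | x , yx , dx = x , y , dx , dy , Adj-sym G yx

  β≢0 : ∀ j → j ℕ.< ρ → β[ j ] ≢ 0ℚ
  β≢0 j j<ρ = let (x , y , dx , dy , xy) = edge-between-levels j j<ρ in
    ℕ→ℚ-≢0 (Card-nonempty (β-count x j j<ρ dx) (xy , dy))

  γ≢0 : ∀ j → j ℕ.< ρ → γ[ suc j ] ≢ 0ℚ
  γ≢0 j j<ρ = let (x , y , dx , dy , xy) = edge-between-levels j j<ρ in
    ℕ→ℚ-≢0 (Card-nonempty (γ-count y j j<ρ dy) (Adj-sym G xy , dx))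

  neighbours-at-level : ∀ x l {m} → Card (λ z → Adj G x z × DistC G C z l) m →
    sum (λ z → A x z * 𝟙 (level z ℕ.≟ l)) ≡ ℕ→ℚ m
  neighbours-at-level x l card = sum-indicator _ card present absent
    where
    present : ∀ z → Adj G x z × DistC G C z l → A x z * 𝟙 (level z ℕ.≟ l) ≡ 1ℚ
    present z (xz , dz) = trans (cong₂ _*_ (AdjMat-adj G xz) (𝟙-yes (level z ℕ.≟ l) (level-unique dz))) (*-identityˡ 1ℚ)
    absent : ∀ z → ¬ (Adj G x z × DistC G C z l) → A x z * 𝟙 (level z ℕ.≟ l) ≡ 0ℚ
    absent z ¬xz with Adj? G x z | level z ℕ.≟ l
    ... | yes xz  | yes lz = ⊥-elim (¬xz (xz , DistC-of-level lz))
    ... | yes _   | no _   = *-zeroʳ (A x z)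
    ... | no ¬xz′ | l?     = trans (cong (_* 𝟙 l?) (AdjMat-¬adj G ¬xz′)) (*-zeroˡ (𝟙 l?))

  α-neighbours : ∀ x → sum (λ z → A x z * 𝟙 (level z ℕ.≟ level x)) ≡ α[ level x ]
  α-neighbours x = neighbours-at-level x (level x) (α-count x (level x) (level≤ρ x) (DistC-level x))

  β-neighbours : ∀ x → sum (λ z → A x z * 𝟙 (level z ℕ.≟ suc (level x))) ≡ β[ level x ]
  β-neighbours x = by-cases (level x ℕ.<? ρ)
    where
    open ≡-Reasoning
    by-cases : Dec (level x ℕ.< ρ) → sum (λ z → A x z * 𝟙 (level z ℕ.≟ suc (level x))) ≡ β[ level x ]
    by-cases (yes lx<ρ) = neighbours-at-level x _ (β-count x (level x) lx<ρ (DistC-level x))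
    by-cases (no lx≮ρ)  = begin
      sum (λ z → A x z * 𝟙 (level z ℕ.≟ suc (level x)))  ≡⟨ sum-cong-≗ none ⟩
      sum {n} (λ _ → 0ℚ)                                 ≡⟨ sum-zero n ⟩
      ℕ→ℚ 0                                              ≡⟨ cong ℕ→ℚ (at-≥ β (ℕ.≮⇒≥ lx≮ρ)) ⟨
      β[ level x ]                                       ∎
      where
      none : ∀ z → A x z * 𝟙 (level z ℕ.≟ suc (level x)) ≡ 0ℚ
      none z = trans (cong (A x z *_) (𝟙-no (level z ℕ.≟ _) (λ e → lx≮ρ (subst (ℕ._≤ ρ) e (level≤ρ z)))))
                     (*-zeroʳ (A x z))

  γ-neighbours : ∀ x → sum (λ z → A x z * 𝟙 (suc (level z) ℕ.≟ level x)) ≡ γ[ level x ]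
  γ-neighbours x = at-level (level x) refl
    where
    at-level : ∀ j → level x ≡ j → sum (λ z → A x z * 𝟙 (suc (level z) ℕ.≟ j)) ≡ γ[ j ]
    at-level zero _ = trans (sum-cong-≗ none) (sum-zero n)
      where
      none : ∀ z → A x z * 𝟙 (suc (level z) ℕ.≟ 0) ≡ 0ℚ
      none z = trans (cong (A x z *_) (𝟙-no (suc (level z) ℕ.≟ 0) ℕ.1+n≢0)) (*-zeroʳ (A x z))
    at-level (suc j) lx≡1+j = trans (sum-cong-≗ shift)
      (neighbours-at-level x j (γ-count x j (subst (ℕ._≤ ρ) lx≡1+j (level≤ρ x)) (DistC-of-level lx≡1+j)))
      where
      shift : ∀ z → A x z * 𝟙 (suc (level z) ℕ.≟ suc j) ≡ A x z * 𝟙 (level z ℕ.≟ j)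
      shift z = cong (A x z *_) (𝟙-cong (suc (level z) ℕ.≟ suc j) (level z ℕ.≟ j) ℕ.suc-injective (cong suc))

  row-sum : ∀ x (g : ℕ → ℚ) → let j = level x in
    sum (λ z → A x z * g (level z)) ≡ α[ j ] * g j + β[ j ] * g (suc j) + γ[ j ] * g (pred j)
  row-sum x g = begin
    sum (λ z → A x z * g (level z))
      ≡⟨ sum-cong-≗ (λ z → trans (AdjMat-*-cong G (split z)) (distrib (A x z) _ _ _ (g j) (g (suc j)) (g (pred j)))) ⟩
    sum (λ z → same z * g j + up z * g (suc j) + down z * g (pred j))
      ≡⟨ sum-linear₃ same up down (g j) (g (suc j)) (g (pred j)) ⟩
    sum same * g j + sum up * g (suc j) + sum down * g (pred j)
      ≡⟨ cong₂ _+_ (cong₂ _+_ (cong (_* g j) (α-neighbours x)) (cong (_* g (suc j)) (β-neighbours x)))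
                   (cong (_* g (pred j)) (γ-neighbours x)) ⟩
    α[ j ] * g j + β[ j ] * g (suc j) + γ[ j ] * g (pred j)  ∎
    where
    open ≡-Reasoning
    j = level x
    same up down : Fin n → ℚ
    same z = A x z * 𝟙 (level z ℕ.≟ j)
    up   z = A x z * 𝟙 (level z ℕ.≟ suc j)
    down z = A x z * 𝟙 (suc (level z) ℕ.≟ j)
    split : ∀ z → Adj G x z → g (level z) ≡
      𝟙 (level z ℕ.≟ j) * g j + 𝟙 (level z ℕ.≟ suc j) * g (suc j) + 𝟙 (suc (level z) ℕ.≟ j) * g (pred j)
    split z xz = split-by-level g (adjacent-levels (DistC-adj xz (DistC-level x) (DistC-level z))
                                                   (DistC-adj (Adj-sym G xz) (DistC-level z) (DistC-level x)))
    distrib : ∀ a e₁ e₂ e₃ u₁ u₂ u₃ →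
      a * (e₁ * u₁ + e₂ * u₂ + e₃ * u₃) ≡ a * e₁ * u₁ + a * e₂ * u₂ + a * e₃ * u₃
    distrib = solve-∀ ℚ-ring

  α+β+γ≡k : ∀ j → j ℕ.≤ ρ → α[ j ] + β[ j ] + γ[ j ] ≡ ℕ→ℚ k
  α+β+γ≡k j j≤ρ = at-vertex (level-nonempty j j≤ρ)
    where
    open ≡-Reasoning
    times-one : ∀ a b c → a + b + c ≡ a * 1ℚ + b * 1ℚ + c * 1ℚ
    times-one = solve-∀ ℚ-ring
    at-vertex : ∃[ x ] DistC G C x j → α[ j ] + β[ j ] + γ[ j ] ≡ ℕ→ℚ k
    at-vertex (x , dx) = subst (λ l → α[ l ] + β[ l ] + γ[ l ] ≡ ℕ→ℚ k) (level-unique dx) (begin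
      α[ l ] + β[ l ] + γ[ l ]                        ≡⟨ times-one α[ l ] β[ l ] γ[ l ] ⟩
      α[ l ] * 1ℚ + β[ l ] * 1ℚ + γ[ l ] * 1ℚ         ≡⟨ row-sum x (λ _ → 1ℚ) ⟨
      sum (λ z → A x z * 1ℚ)                          ≡⟨ sum-cong-≗ (λ z → *-identityʳ (A x z)) ⟩
      sum (A x)                                       ≡⟨ degree G reg x ⟩
      ℕ→ℚ k                                           ∎)
      where
      l = level x

  eigensequence⇒eigenvector : ∀ {θ v} → Eigensequence α[_] θ v → IsEigenvector A θ (λ x → v (level x))
  eigensequence⇒eigenvector {θ} {v} rows x = trans (row-sum x v) (rows (level x) (level≤ρ x))

  _∩level?_ : ∀ (K : Subset n) l z → Dec (z ∈ K × DistC G C z l)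
  (K ∩level? l) z = (z ∈? K) ×-dec map′ DistC-of-level level-unique (level z ℕ.≟ l)

  ∣_∩level_∣ : Subset n → ℕ → ℕ
  ∣ K ∩level l ∣ = length (filter (K ∩level? l) (allFin n))

  Card-∩level : ∀ K l → Card (λ z → z ∈ K × DistC G C z l) ∣ K ∩level l ∣
  Card-∩level K l = Card-filter (K ∩level? l)

  sum-over-two-levels : ∀ K i → (∀ z → z ∈ K → DistC G C z i ⊎ DistC G C z (suc i)) → ∀ (g : ℕ → ℚ) →
    sum (λ z → 𝟙 (z ∈? K) * g (level z)) ≡ ℕ→ℚ ∣ K ∩level i ∣ * g i + ℕ→ℚ ∣ K ∩level suc i ∣ * g (suc i)
  sum-over-two-levels K i K⊆ g = begin
    sum (λ z → 𝟙 (z ∈? K) * g (level z))          ≡⟨ sum-cong-≗ split ⟩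
    sum (λ z → χ i z * g i + χ (suc i) z * g (suc i))
      ≡⟨ ∑-distrib-+ (λ z → χ i z * g i) (λ z → χ (suc i) z * g (suc i)) ⟩
    sum (λ z → χ i z * g i) + sum (λ z → χ (suc i) z * g (suc i))
      ≡⟨ cong₂ _+_ (trans (sum-*ʳ (g i) (χ i)) (cong (_* g i) (count i)))
                   (trans (sum-*ʳ (g (suc i)) (χ (suc i))) (cong (_* g (suc i)) (count (suc i)))) ⟩
    ℕ→ℚ ∣ K ∩level i ∣ * g i + ℕ→ℚ ∣ K ∩level suc i ∣ * g (suc i)   ∎
    where
    open ≡-Reasoning
    χ : ℕ → Fin n → ℚ
    χ l z = 𝟙 (z ∈? K) * 𝟙 (level z ℕ.≟ l)
    count : ∀ l → sum (χ l) ≡ ℕ→ℚ ∣ K ∩level l ∣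
    count l = sum-indicator (χ l) (Card-∩level K l)
      (λ z (z∈K , dz) → trans (cong₂ _*_ (𝟙-yes (z ∈? K) z∈K) (𝟙-yes (level z ℕ.≟ l) (level-unique dz))) (*-identityˡ 1ℚ))
      (λ z ¬P → absent z ¬P (z ∈? K) (level z ℕ.≟ l))
      where
      absent : ∀ z → ¬ (z ∈ K × DistC G C z l) → (z∈? : Dec (z ∈ K)) (l? : Dec (level z ≡ l)) → 𝟙 z∈? * 𝟙 l? ≡ 0ℚ
      absent z ¬P (yes z∈K) (yes lz) = ⊥-elim (¬P (z∈K , DistC-of-level lz))
      absent z ¬P (yes _)   (no _)   = *-zeroʳ 1ℚ
      absent z ¬P (no _)    l?       = *-zeroˡ (𝟙 l?)
    split : ∀ z → 𝟙 (z ∈? K) * g (level z) ≡ χ i z * g i + χ (suc i) z * g (suc i)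
    split z with z ∈? K
    ... | no _ = vanish (g (level z)) (𝟙 (level z ℕ.≟ i)) (g i) (𝟙 (level z ℕ.≟ suc i)) (g (suc i))
      where
      vanish : ∀ u e₁ u₁ e₂ u₂ → 0ℚ * u ≡ 0ℚ * e₁ * u₁ + 0ℚ * e₂ * u₂
      vanish = solve-∀ ℚ-ring
    ... | yes z∈K with K⊆ z z∈K
    ...   | inj₁ dz rewrite level-unique dz
                          | 𝟙-yes (i ℕ.≟ i) refl | 𝟙-no (i ℕ.≟ suc i) (n≢1+n i) = first (g i) (g (suc i))
      where
      first : ∀ u u′ → 1ℚ * u ≡ 1ℚ * 1ℚ * u + 1ℚ * 0ℚ * u′
      first = solve-∀ ℚ-ring
    ...   | inj₂ dz rewrite level-unique dz
                          | 𝟙-no (suc i ℕ.≟ i) ℕ.1+n≢n | 𝟙-yes (suc i ℕ.≟ suc i) refl = second (g i) (g (suc i))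
      where
      second : ∀ u u′ → 1ℚ * u′ ≡ 1ℚ * 0ℚ * u + 1ℚ * 1ℚ * u′
      second = solve-∀ ℚ-ring

  between-levels : ∀ {z i} → i ℕ.≤ level z → level z ℕ.≤ suc i → DistC G C z i ⊎ DistC G C z (suc i)
  between-levels i≤lz lz≤1+i with ℕ.m≤n⇒m<n∨m≡n lz≤1+i
  ... | inj₁ lz<1+i = inj₁ (DistC-of-level (ℕ.≤-antisym (ℕ.≤-pred lz<1+i) i≤lz))
  ... | inj₂ lz≡1+i = inj₂ (DistC-of-level lz≡1+i)

  clique-levels : ∀ {K} → IsClique G K → ∀ {x y i} → x ∈ K → y ∈ K → DistC G C x i → DistC G C y (suc i) →
    ∀ z → z ∈ K → DistC G C z i ⊎ DistC G C z (suc i)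
  clique-levels {K} clq {x} {y} {i} x∈K y∈K dx dy z z∈K with x ≟ z | y ≟ z
  ... | yes refl | _        = inj₁ dx
  ... | _        | yes refl = inj₂ dy
  ... | no x≢z   | no y≢z   = between-levels
    (ℕ.≤-pred (DistC-adj (clq z y z∈K y∈K (≢-sym y≢z)) (DistC-level z) dy))
    (DistC-adj (clq x z x∈K z∈K x≢z) dx (DistC-level z))

-- The eigensequence of the intersection matrix

-- Bounded search; the junk value from + r means that no j ∈ [from, from + r) satisfies P.
least : {P : ℕ → Set} → (∀ j → Dec (P j)) → ℕ → ℕ → ℕ
least P? from zero    = from
least P? from (suc r) with P? from
... | yes _ = from
... | no _  = least P? (suc from) r

least-correct : ∀ {P : ℕ → Set} (P? : ∀ j → Dec (P j)) from r {j} → from ℕ.≤ j → j ℕ.< from ℕ.+ r → P j →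
  from ℕ.≤ least P? from r × least P? from r ℕ.≤ j × P (least P? from r)
least-correct P? from zero    from≤j j<from+0 _ =
  ⊥-elim (ℕ.<-irrefl refl (ℕ.<-≤-trans (subst (_ ℕ.<_) (ℕ.+-identityʳ from) j<from+0) from≤j))
least-correct P? from (suc r) {j} from≤j j<from+1+r Pj with P? from
... | yes P-from = ℕ.≤-refl , from≤j , P-from
... | no ¬P-from with ℕ.m≤n⇒m<n∨m≡n from≤j
...   | inj₂ refl    = ⊥-elim (¬P-from Pj)
...   | inj₁ from<j with least-correct P? (suc from) r from<j (subst (j ℕ.<_) (ℕ.+-suc from r) j<from+1+r) Pj
...     | from<least , least≤j , P-least = ℕ.<⇒≤ from<least , least≤j , P-least

-- The smallest eigenvalue θ of a k-regular graph with Delsarte cliques of size j + 1: (j + 1) θ = θ - k.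
delsarte-eigenvalue : ℕ → ℕ → ℚ
delsarte-eigenvalue k j = - (ℕ→ℚ k * (ℕ→ℚ j) ⁻¹)

delsarte-eigenvalue-* : ∀ k {j} → 1 ℕ.≤ j → ℕ→ℚ j * delsarte-eigenvalue k j ≡ - ℕ→ℚ k
delsarte-eigenvalue-* k {j} 1≤j = begin
  ℕ→ℚ j * - (ℕ→ℚ k * (ℕ→ℚ j) ⁻¹)     ≡⟨ rearrange (ℕ→ℚ j) (ℕ→ℚ k) ((ℕ→ℚ j) ⁻¹) ⟩
  - ℕ→ℚ k * (ℕ→ℚ j * (ℕ→ℚ j) ⁻¹)     ≡⟨ cong (- ℕ→ℚ k *_) (⁻¹-inverseʳ (ℕ→ℚ-≢0 1≤j)) ⟩
  - ℕ→ℚ k * 1ℚ                        ≡⟨ *-identityʳ (- ℕ→ℚ k) ⟩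
  - ℕ→ℚ k                             ∎
  where
  open ≡-Reasoning
  rearrange : ∀ j k i → j * - (k * i) ≡ - k * (j * i)
  rearrange = solve-∀ ℚ-ring

delsarte-eigenvalue-unique : ∀ k {j θ} → 1 ℕ.≤ j → ℕ→ℚ j * θ ≡ - ℕ→ℚ k → θ ≡ delsarte-eigenvalue k j
delsarte-eigenvalue-unique k 1≤j jθ≡-k = *-cancelˡ-≢0 (ℕ→ℚ-≢0 1≤j) (trans jθ≡-k (sym (delsarte-eigenvalue-* k 1≤j)))

delsarte-eigenvalue-mono : ∀ k {j j′} → 1 ℕ.≤ j → j ℕ.≤ j′ → delsarte-eigenvalue k j ≤ delsarte-eigenvalue k j′
delsarte-eigenvalue-mono k {suc j} {suc j′} _ j≤j′ =
  *-cancelˡ-≤-pos (ℕ→ℚ (suc j)) {{ℚ.positive (ℕ→ℚ-pos j)}} (begin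
    ℕ→ℚ (suc j) * x      ≡⟨ delsarte-eigenvalue-* k {suc j} (s≤s z≤n) ⟩
    - ℕ→ℚ k              ≡⟨ delsarte-eigenvalue-* k {suc j′} (s≤s z≤n) ⟨
    ℕ→ℚ (suc j′) * y     ≤⟨ *-monoʳ-≤-nonPos y {{ℚ.nonPositive y≤0}} (ℕ→ℚ-mono-≤ j≤j′) ⟩
    ℕ→ℚ (suc j) * y      ∎)
  where
  open ≤-Reasoning
  x = delsarte-eigenvalue k (suc j)
  y = delsarte-eigenvalue k (suc j′)
  -k≤0 : - ℕ→ℚ k ≤ 0ℚ
  -k≤0 = neg-antimono-≤ (ℕ→ℚ-nonNeg k)
  y≤0 : y ≤ 0ℚ
  y≤0 = *-cancelˡ-≤-pos (ℕ→ℚ (suc j′)) {{ℚ.positive (ℕ→ℚ-pos j′)}}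
          (subst₂ _≤_ (sym (delsarte-eigenvalue-* k {suc j′} (s≤s z≤n))) (sym (*-zeroʳ (ℕ→ℚ (suc j′)))) -k≤0)

module Recurrence (k ρ : ℕ) (β γ : Vec ℕ ρ) where

  open IntersectionNumbers β γ public

  -- The diagonal α_j = k - β_j - γ_j of the intersection matrix, forced by regularity.
  a[_] : ℕ → ℚ
  a[ j ] = ℕ→ℚ k - β[ j ] - γ[ j ]

  residual : ℚ → (ℕ → ℚ) → ℕ → ℚ
  residual θ w j = (θ - a[ j ]) * w j - γ[ j ] * w (pred j)

  Row⇒β*next : ∀ {θ w j} → Row a[_] θ w j → β[ j ] * w (suc j) ≡ residual θ w j
  Row⇒β*next {θ} {w} {j} row = begin
    β[ j ] * w (suc j)                                              ≡⟨ isolate a[ j ] β[ j ] γ[ j ] _ _ _ ⟩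
    a[ j ] * w j + β[ j ] * w (suc j) + γ[ j ] * w (pred j) - a[ j ] * w j - γ[ j ] * w (pred j)
      ≡⟨ cong (λ t → t - a[ j ] * w j - γ[ j ] * w (pred j)) row ⟩
    θ * w j - a[ j ] * w j - γ[ j ] * w (pred j)                    ≡⟨ factor θ a[ j ] γ[ j ] _ _ ⟩
    residual θ w j                                                  ∎
    where
    open ≡-Reasoning
    isolate : ∀ a b c u₀ u₁ u₋ → b * u₁ ≡ a * u₀ + b * u₁ + c * u₋ - a * u₀ - c * u₋
    isolate = solve-∀ ℚ-ring
    factor : ∀ t a c u₀ u₋ → t * u₀ - a * u₀ - c * u₋ ≡ (t - a) * u₀ - c * u₋
    factor = solve-∀ ℚ-ring

  β*next⇒Row : ∀ {θ w j} → β[ j ] * w (suc j) ≡ residual θ w j → Row a[_] θ w j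
  β*next⇒Row {θ} {w} {j} next = begin
    a[ j ] * w j + β[ j ] * w (suc j) + γ[ j ] * w (pred j)   ≡⟨ cong (λ t → a[ j ] * w j + t + γ[ j ] * w (pred j)) next ⟩
    a[ j ] * w j + residual θ w j + γ[ j ] * w (pred j)       ≡⟨ cancel θ a[ j ] γ[ j ] _ _ ⟩
    θ * w j                                                   ∎
    where
    open ≡-Reasoning
    cancel : ∀ t a c u₀ u₋ → a * u₀ + ((t - a) * u₀ - c * u₋) + c * u₋ ≡ t * u₀
    cancel = solve-∀ ℚ-ring

  -- Row j solved for the (j + 1)-st entry, normalised by v θ 0 = 1.
  v : ℚ → ℕ → ℚ
  v θ zero          = 1ℚ
  v θ (suc zero)    = ((θ - a[ 0 ]) * 1ℚ - γ[ 0 ] * 1ℚ) * β[ 0 ] ⁻¹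
  v θ (suc (suc j)) = ((θ - a[ suc j ]) * v θ (suc j) - γ[ suc j ] * v θ j) * β[ suc j ] ⁻¹

  v-suc : ∀ θ j → v θ (suc j) ≡ residual θ (v θ) j * β[ j ] ⁻¹
  v-suc θ zero    = refl
  v-suc θ (suc j) = refl

  -- Up to the factor β_0 ⋯ β_{ρ-1}, χ is the characteristic polynomial of the intersection matrix.
  χ : ℚ → ℚ
  χ θ = residual θ (v θ) ρ

  module _ (β≢0 : ∀ j → j ℕ.< ρ → β[ j ] ≢ 0ℚ) where

    β*v-suc : ∀ θ j → j ℕ.< ρ → β[ j ] * v θ (suc j) ≡ residual θ (v θ) j
    β*v-suc θ j j<ρ = begin
      β[ j ] * v θ (suc j)                           ≡⟨ cong (β[ j ] *_) (trans (v-suc θ j) (*-comm _ (β[ j ] ⁻¹))) ⟩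
      β[ j ] * (β[ j ] ⁻¹ * residual θ (v θ) j)      ≡⟨ *-assoc β[ j ] (β[ j ] ⁻¹) _ ⟨
      β[ j ] * β[ j ] ⁻¹ * residual θ (v θ) j        ≡⟨ cong (_* residual θ (v θ) j) (⁻¹-inverseʳ (β≢0 j j<ρ)) ⟩
      1ℚ * residual θ (v θ) j                        ≡⟨ *-identityˡ _ ⟩
      residual θ (v θ) j                             ∎
      where open ≡-Reasoning

    v-eigensequence : ∀ {θ} → χ θ ≡ 0ℚ → Eigensequence a[_] θ (v θ)
    v-eigensequence {θ} χθ≡0 j j≤ρ = β*next⇒Row {θ} {v θ} {j} (β*next (ℕ.m≤n⇒m<n∨m≡n j≤ρ))
      where
      β*next : j ℕ.< ρ ⊎ j ≡ ρ → β[ j ] * v θ (suc j) ≡ residual θ (v θ) j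
      β*next (inj₁ j<ρ) = β*v-suc θ j j<ρ
      β*next (inj₂ refl) = trans (cong (_* v θ (suc ρ)) β[ρ]≡0) (trans (*-zeroˡ (v θ (suc ρ))) (sym χθ≡0))

    module _ {θ : ℚ} {w : ℕ → ℚ} (rows : Eigensequence a[_] θ w) where

      residual-scaled : ∀ j → w j ≡ w 0 * v θ j → w (pred j) ≡ w 0 * v θ (pred j) →
        residual θ w j ≡ w 0 * residual θ (v θ) j
      residual-scaled j wj wj₋ = trans (cong₂ (λ p q → (θ - a[ j ]) * p - γ[ j ] * q) wj wj₋)
        (scale (θ - a[ j ]) γ[ j ] (w 0) (v θ j) (v θ (pred j)))
        where
        scale : ∀ t c s u₀ u₋ → t * (s * u₀) - c * (s * u₋) ≡ s * (t * u₀ - c * u₋)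
        scale = solve-∀ ℚ-ring

      eigensequence≡scaled-v : ∀ j → j ℕ.≤ ρ → (w j ≡ w 0 * v θ j) × (w (pred j) ≡ w 0 * v θ (pred j))
      eigensequence≡scaled-v zero _ = sym (*-identityʳ (w 0)) , sym (*-identityʳ (w 0))
      eigensequence≡scaled-v (suc j) j<ρ with eigensequence≡scaled-v j (ℕ.<⇒≤ j<ρ)
      ... | wj , wj₋ = w[1+j] , wj
        where
        open ≡-Reasoning
        rearrange : ∀ i s r → i * (s * r) ≡ s * (r * i)
        rearrange = solve-∀ ℚ-ring
        w[1+j] : w (suc j) ≡ w 0 * v θ (suc j)
        w[1+j] = begin
          w (suc j)                                      ≡⟨ ⁻¹-cancelˡ (w (suc j)) (β≢0 j j<ρ) ⟨
          β[ j ] ⁻¹ * (β[ j ] * w (suc j))               ≡⟨ cong (β[ j ] ⁻¹ *_) (Row⇒β*next {θ} {w} {j} (rows j (ℕ.<⇒≤ j<ρ))) ⟩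
          β[ j ] ⁻¹ * residual θ w j                     ≡⟨ cong (β[ j ] ⁻¹ *_) (residual-scaled j wj wj₋) ⟩
          β[ j ] ⁻¹ * (w 0 * residual θ (v θ) j)         ≡⟨ rearrange (β[ j ] ⁻¹) (w 0) _ ⟩
          w 0 * (residual θ (v θ) j * β[ j ] ⁻¹)         ≡⟨ cong (w 0 *_) (v-suc θ j) ⟨
          w 0 * v θ (suc j)                              ∎

      eigensequence⇒χ≡0 : ∀ {j} → j ℕ.≤ ρ → w j ≢ 0ℚ → χ θ ≡ 0ℚ
      eigensequence⇒χ≡0 {j} j≤ρ wj≢0 = *≡0⇒≡0 w0≢0 (begin
        w 0 * χ θ                 ≡⟨ residual-scaled ρ wρ wρ₋ ⟨
        residual θ w ρ            ≡⟨ Row⇒β*next {θ} {w} {ρ} (rows ρ ℕ.≤-refl) ⟨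
        β[ ρ ] * w (suc ρ)        ≡⟨ cong (_* w (suc ρ)) β[ρ]≡0 ⟩
        0ℚ * w (suc ρ)            ≡⟨ *-zeroˡ (w (suc ρ)) ⟩
        0ℚ                        ∎)
        where
        open ≡-Reasoning
        wρ = proj₁ (eigensequence≡scaled-v ρ ℕ.≤-refl)
        wρ₋ = proj₂ (eigensequence≡scaled-v ρ ℕ.≤-refl)
        w0≢0 : w 0 ≢ 0ℚ
        w0≢0 w0≡0 = wj≢0 (trans (proj₁ (eigensequence≡scaled-v j j≤ρ)) (trans (cong (_* v θ j) w0≡0) (*-zeroˡ (v θ j))))

    module _ (γ≢0 : ∀ j → j ℕ.< ρ → γ[ suc j ] ≢ 0ℚ) where

      no-consecutive-zeros : ∀ θ i → i ℕ.< ρ → v θ i ≡ 0ℚ → v θ (suc i) ≡ 0ℚ → ⊥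
      no-consecutive-zeros θ zero    _     v₀≡0 _    = 1≢0 v₀≡0
      no-consecutive-zeros θ (suc i) 1+i<ρ v₁≡0 v₂≡0 =
        no-consecutive-zeros θ i i<ρ (*≡0⇒≡0 (γ≢0 i i<ρ) γv₀≡0) v₁≡0
        where
        open ≡-Reasoning
        i<ρ : i ℕ.< ρ
        i<ρ = ℕ.<-trans (ℕ.n<1+n i) 1+i<ρ
        t = θ - a[ suc i ]
        residual≡0 : residual θ (v θ) (suc i) ≡ 0ℚ
        residual≡0 = trans (sym (β*v-suc θ (suc i) 1+i<ρ)) (trans (cong (β[ suc i ] *_) v₂≡0) (*-zeroʳ β[ suc i ]))
        isolate : ∀ t c u₁ u₀ → c * u₀ ≡ t * u₁ - (t * u₁ - c * u₀)
        isolate = solve-∀ ℚ-ring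
        vanish : ∀ t → t * 0ℚ - 0ℚ ≡ 0ℚ
        vanish = solve-∀ ℚ-ring
        γv₀≡0 : γ[ suc i ] * v θ i ≡ 0ℚ
        γv₀≡0 = begin
          γ[ suc i ] * v θ i                                ≡⟨ isolate t γ[ suc i ] (v θ (suc i)) (v θ i) ⟩
          t * v θ (suc i) - residual θ (v θ) (suc i)        ≡⟨ cong₂ (λ p q → t * p - q) v₁≡0 residual≡0 ⟩
          t * 0ℚ - 0ℚ                                       ≡⟨ vanish t ⟩
          0ℚ                                                ∎

      balance⇒count : ∀ θ i {s m} → i ℕ.< ρ → s ≢ 0ℚ → m * v θ i + (s - m) * v θ (suc i) ≡ 0ℚ →
        m ≡ s * v θ (suc i) * (v θ (suc i) - v θ i) ⁻¹
      balance⇒count θ i {s} {m} i<ρ s≢0 balance = begin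
        m                          ≡⟨ *-identityʳ m ⟨
        m * 1ℚ                     ≡⟨ cong (m *_) (⁻¹-inverseʳ d≢0) ⟨
        m * (d * d ⁻¹)             ≡⟨ *-assoc m d (d ⁻¹) ⟨
        m * d * d ⁻¹               ≡⟨ cong (_* d ⁻¹) md≡su₁ ⟩
        s * u₁ * d ⁻¹              ∎
        where
        open ≡-Reasoning
        u₀ = v θ i
        u₁ = v θ (suc i)
        d = u₁ - u₀
        expand : ∀ m s u₀ u₁ → m * (u₁ - u₀) ≡ s * u₁ - (m * u₀ + (s - m) * u₁)
        expand = solve-∀ ℚ-ring
        md≡su₁ : m * d ≡ s * u₁
        md≡su₁ = trans (expand m s u₀ u₁) (trans (cong (_-_ (s * u₁)) balance) (+-identityʳ (s * u₁)))
        d≢0 : d ≢ 0ℚ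
        d≢0 d≡0 = no-consecutive-zeros θ i i<ρ u₀≡0 u₁≡0
          where
          u₁≡0 : u₁ ≡ 0ℚ
          u₁≡0 = *≡0⇒≡0 s≢0 (trans (sym md≡su₁) (trans (cong (m *_) d≡0) (*-zeroʳ m)))
          u₀≡0 : u₀ ≡ 0ℚ
          u₀≡0 = trans (x≡x-[x-y] u₁ u₀) (trans (cong₂ _-_ u₁≡0 d≡0) (+-inverseʳ 0ℚ))
            where
            x≡x-[x-y] : ∀ x y → y ≡ x - (x - y)
            x≡x-[x-y] = solve-∀ ℚ-ring

  -- Least j ∈ [1, k] with χ (-k / j) = 0; in the theorem this is |K| - 1 for every clique K.
  j* : ℕ
  j* = least (λ j → χ (delsarte-eigenvalue k j) ≟ℚ 0ℚ) 1 k

  θ* : ℚ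
  θ* = delsarte-eigenvalue k j*

  coefficient : ℕ → ℚ
  coefficient i = ℕ→ℚ (suc j*) * v θ* (suc i) * (v θ* (suc i) - v θ* i) ⁻¹

extend : ∀ {m} → (Fin m → ℚ) → ℕ → ℚ
extend {zero}  w _       = 0ℚ
extend {suc m} w zero    = w zero
extend {suc m} w (suc t) = extend (λ i → w (suc i)) t

extend-toℕ : ∀ {m} (w : Fin m → ℚ) i → extend w (toℕ i) ≡ w i
extend-toℕ w zero    = refl
extend-toℕ w (suc i) = extend-toℕ (λ i → w (suc i)) i

sum-pick : ∀ {m} (w : Fin m → ℚ) c t → sum (λ j → 𝟙 (toℕ j ℕ.≟ t) * (c * w j)) ≡ c * extend w t
sum-pick {zero}  w c t = sym (*-zeroʳ c)
sum-pick {suc m} w c zero = begin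
  1ℚ * (c * w zero) + sum (λ j → 𝟙 (suc (toℕ j) ℕ.≟ 0) * (c * w (suc j)))
    ≡⟨ cong₂ _+_ (*-identityˡ (c * w zero)) (sum-cong-≗ drop) ⟩
  c * w zero + sum {m} (λ _ → 0ℚ)   ≡⟨ cong (c * w zero +_) (sum-zero m) ⟩
  c * w zero + 0ℚ                   ≡⟨ +-identityʳ (c * w zero) ⟩
  c * w zero                        ∎
  where
  open ≡-Reasoning
  drop : ∀ j → 𝟙 (suc (toℕ j) ℕ.≟ 0) * (c * w (suc j)) ≡ 0ℚ
  drop j = trans (cong (_* (c * w (suc j))) (𝟙-no (suc (toℕ j) ℕ.≟ 0) ℕ.1+n≢0)) (*-zeroˡ (c * w (suc j)))
sum-pick {suc m} w c (suc t) = begin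
  0ℚ * (c * w zero) + sum (λ j → 𝟙 (suc (toℕ j) ℕ.≟ suc t) * (c * w (suc j)))
    ≡⟨ cong₂ _+_ (*-zeroˡ (c * w zero)) (sum-cong-≗ shift) ⟩
  0ℚ + sum (λ j → 𝟙 (toℕ j ℕ.≟ t) * (c * w (suc j)))   ≡⟨ +-identityˡ _ ⟩
  sum (λ j → 𝟙 (toℕ j ℕ.≟ t) * (c * w (suc j)))        ≡⟨ sum-pick (λ j → w (suc j)) c t ⟩
  c * extend (λ j → w (suc j)) t                       ∎
  where
  open ≡-Reasoning
  shift : ∀ j → 𝟙 (suc (toℕ j) ℕ.≟ suc t) * (c * w (suc j)) ≡ 𝟙 (toℕ j ℕ.≟ t) * (c * w (suc j))
  shift j = cong (_* (c * w (suc j))) (𝟙-cong (suc (toℕ j) ℕ.≟ suc t) (toℕ j ℕ.≟ t) ℕ.suc-injective (cong suc))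

module IntersectionMatrixRows {ρ} (α : Vec ℕ (suc ρ)) (β γ : Vec ℕ ρ) where

  open IntersectionNumbers β γ

  α[_] : ℕ → ℚ
  α[ j ] = ℕ→ℚ (at α j)

  entry-spec : ∀ i j → ℕ→ℚ (entry α β γ i j) ≡
    𝟙 (j ℕ.≟ i) * α[ i ] + 𝟙 (j ℕ.≟ suc i) * β[ i ] + 𝟙 (suc j ℕ.≟ i) * γ[ i ]
  entry-spec i j with i ℕ.≟ j
  ... | yes refl = trans (select₁ α[ i ] β[ i ] γ[ i ])
    (sym (coeffs-cong _ _ _ (𝟙-yes (i ℕ.≟ i) refl) (𝟙-no (i ℕ.≟ suc i) (n≢1+n i)) (𝟙-no (suc i ℕ.≟ i) ℕ.1+n≢n)))
  ... | no i≢j with suc i ℕ.≟ j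
  ...   | yes refl = trans (select₂ α[ i ] β[ i ] γ[ i ])
    (sym (coeffs-cong _ _ _ (𝟙-no (suc i ℕ.≟ i) ℕ.1+n≢n) (𝟙-yes (suc i ℕ.≟ suc i) refl) (𝟙-no (suc (suc i) ℕ.≟ i) (≢-sym (n≢2+n i)))))
  ...   | no 1+i≢j with i ℕ.≟ suc j
  ...     | yes refl = trans (select₃ α[ suc j ] β[ suc j ] γ[ suc j ])
    (sym (coeffs-cong _ _ _ (𝟙-no (j ℕ.≟ suc j) (n≢1+n j)) (𝟙-no (j ℕ.≟ suc (suc j)) (n≢2+n j)) (𝟙-yes (suc j ℕ.≟ suc j) refl)))
  ...     | no i≢1+j = trans (none α[ i ] β[ i ] γ[ i ])
    (sym (coeffs-cong _ _ _ (𝟙-no (j ℕ.≟ i) (≢-sym i≢j)) (𝟙-no (j ℕ.≟ suc i) (≢-sym 1+i≢j)) (𝟙-no (suc j ℕ.≟ i) (≢-sym i≢1+j))))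
    where
    none : ∀ x y z → 0ℚ ≡ 0ℚ * x + 0ℚ * y + 0ℚ * z
    none = solve-∀ ℚ-ring

  row-sum : ∀ (w : Fin (suc ρ) → ℚ) i → let t = toℕ i ; W = extend w in
    sum (λ j → IntersectionMatrix α β γ i j * w j) ≡ α[ t ] * W t + β[ t ] * W (suc t) + γ[ t ] * W (pred t)
  row-sum w i = begin
    sum (λ j → IntersectionMatrix α β γ i j * w j)   ≡⟨ sum-cong-≗ split ⟩
    sum (λ j → same j + up j + down j)               ≡⟨ ∑-distrib-+ (λ j → same j + up j) down ⟩
    sum (λ j → same j + up j) + sum down             ≡⟨ cong (_+ sum down) (∑-distrib-+ same up) ⟩
    sum same + sum up + sum down
      ≡⟨ cong₂ _+_ (cong₂ _+_ (sum-pick w α[ t ] t) (sum-pick w β[ t ] (suc t))) (sum-down t) ⟩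
    α[ t ] * W t + β[ t ] * W (suc t) + γ[ t ] * W (pred t)  ∎
    where
    open ≡-Reasoning
    t = toℕ i
    W = extend w
    same up : Fin (suc ρ) → ℚ
    same j = 𝟙 (toℕ j ℕ.≟ t) * (α[ t ] * w j)
    up   j = 𝟙 (toℕ j ℕ.≟ suc t) * (β[ t ] * w j)
    down-at : ℕ → Fin (suc ρ) → ℚ
    down-at s j = 𝟙 (suc (toℕ j) ℕ.≟ s) * (γ[ s ] * w j)
    down = down-at t
    distrib : ∀ e₁ e₂ e₃ a b c u → (e₁ * a + e₂ * b + e₃ * c) * u ≡ e₁ * (a * u) + e₂ * (b * u) + e₃ * (c * u)
    distrib = solve-∀ ℚ-ring
    split : ∀ j → IntersectionMatrix α β γ i j * w j ≡ same j + up j + down j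
    split j = trans (cong (_* w j) (entry-spec t (toℕ j)))
      (distrib (𝟙 (toℕ j ℕ.≟ t)) (𝟙 (toℕ j ℕ.≟ suc t)) (𝟙 (suc (toℕ j) ℕ.≟ t)) α[ t ] β[ t ] γ[ t ] (w j))
    sum-down : ∀ s → sum (down-at s) ≡ γ[ s ] * W (pred s)
    sum-down zero = begin
      sum (down-at 0)             ≡⟨ sum-cong-≗ none ⟩
      sum {suc ρ} (λ _ → 0ℚ)     ≡⟨ sum-zero (suc ρ) ⟩
      0ℚ                         ≡⟨ *-zeroˡ (W 0) ⟨
      0ℚ * W 0                   ∎
      where
      none : ∀ j → down-at 0 j ≡ 0ℚ
      none j = trans (cong (𝟙 (suc (toℕ j) ℕ.≟ 0) *_) (*-zeroˡ (w j))) (*-zeroʳ (𝟙 (suc (toℕ j) ℕ.≟ 0)))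
    sum-down (suc s) = trans (sum-cong-≗ shift) (sum-pick w γ[ suc s ] s)
      where
      shift : ∀ j → down-at (suc s) j ≡ 𝟙 (toℕ j ℕ.≟ s) * (γ[ suc s ] * w j)
      shift j = cong (_* (γ[ suc s ] * w j)) (𝟙-cong (suc (toℕ j) ℕ.≟ suc s) (toℕ j ℕ.≟ s) ℕ.suc-injective (cong suc))

  InSpec⇒eigensequence : ∀ {θ} → InSpec θ α β γ →
    Σ (ℕ → ℚ) λ W → Eigensequence α[_] θ W × ∃[ j ] (j ℕ.≤ ρ × W j ≢ 0ℚ)
  InSpec⇒eigensequence {θ} (w , (i , wi≢0) , eigen) = extend w , rows , toℕ i , ℕ.≤-pred (Fin.toℕ<n i) , W-toℕi≢0
    where
    W-toℕi≢0 : extend w (toℕ i) ≢ 0ℚ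
    W-toℕi≢0 e = wi≢0 (trans (sym (extend-toℕ w i)) e)
    row-at : ∀ i → Row α[_] θ (extend w) (toℕ i)
    row-at i = begin
      α[ toℕ i ] * extend w (toℕ i) + β[ toℕ i ] * extend w (suc (toℕ i)) + γ[ toℕ i ] * extend w (pred (toℕ i))
        ≡⟨ row-sum w i ⟨
      sum (λ j → IntersectionMatrix α β γ i j * w j)   ≡⟨ Σℚ≡sum (λ j → IntersectionMatrix α β γ i j * w j) ⟨
      Σℚ (λ j → IntersectionMatrix α β γ i j * w j)    ≡⟨ eigen i ⟩
      θ * w i                                          ≡⟨ cong (θ *_) (extend-toℕ w i) ⟨
      θ * extend w (toℕ i)                             ∎
      where open ≡-Reasoning
    rows : Eigensequence α[_] θ (extend w)
    rows t t≤ρ = subst (Row α[_] θ (extend w)) (Fin.toℕ-fromℕ< (s≤s t≤ρ)) (row-at (fromℕ< (s≤s t≤ρ)))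

-- Geometric graphs

module GeometricGraph {n} (G : Graph n) {k θ 𝒦} (geo : IsGeometric G k θ 𝒦) (reg : Regular G k) (θ≢0 : θ ≢ 0ℚ) where

  A : Fin n → Fin n → ℚ
  A = AdjMat G

  𝟙[_] : Subset n → Fin n → ℚ
  𝟙[ K ] z = 𝟙 (z ∈? K)

  opaque
    -- The clique of 𝒦 through the edge xy; a junk value when x and y are not adjacent.
    -- Opaque, so that case analysis on adjacency elsewhere leaves it folded.
    clique : Fin n → Fin n → Subset n
    clique x y with Adj? G x y
    ... | yes xy = proj₁ (proj₂ geo x y xy)
    ... | no _   = Subset.⊥

    clique-spec : ∀ {x y} → Adj G x y → 𝒦 (clique x y) × x ∈ clique x y × y ∈ clique x y ×
                  (∀ K → 𝒦 K → x ∈ K → y ∈ K → K ≡ clique x y)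
    clique-spec {x} {y} xy with Adj? G x y
    ... | yes xy′ = proj₂ (proj₂ geo x y xy′)
    ... | no ¬xy  = ⊥-elim (¬xy xy)

  clique∈𝒦 : ∀ {x y} → Adj G x y → 𝒦 (clique x y)
  clique∈𝒦 xy = proj₁ (clique-spec xy)

  clique∋ˡ : ∀ {x y} → Adj G x y → x ∈ clique x y
  clique∋ˡ xy = proj₁ (proj₂ (clique-spec xy))

  clique∋ʳ : ∀ {x y} → Adj G x y → y ∈ clique x y
  clique∋ʳ xy = proj₁ (proj₂ (proj₂ (clique-spec xy)))

  clique-unique : ∀ {x y} → Adj G x y → ∀ K → 𝒦 K → x ∈ K → y ∈ K → K ≡ clique x y
  clique-unique xy = proj₂ (proj₂ (proj₂ (clique-spec xy)))

  clique-sym : ∀ {x y} → Adj G x y → clique x y ≡ clique y x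
  clique-sym xy = clique-unique (Adj-sym G xy) _ (clique∈𝒦 xy) (clique∋ʳ xy) (clique∋ˡ xy)

  clique-through : ∀ {x y w} → Adj G x y → w ∈ clique x y → x ≢ w → Adj G x w × clique x w ≡ clique x y
  clique-through {x} {y} {w} xy w∈ x≢w =
    xw , sym (clique-unique xw (clique x y) (clique∈𝒦 xy) (clique∋ˡ xy) w∈)
    where
    xw : Adj G x w
    xw = proj₁ (proj₁ geo _ (clique∈𝒦 xy)) x w (clique∋ˡ xy) w∈ x≢w

  σ : ℚ
  σ = (θ - ℕ→ℚ k) * θ ⁻¹

  clique-size : ∀ {K} → 𝒦 K → sum 𝟙[ K ] ≡ σ
  clique-size {K} K∈𝒦 = from-delsarte (proj₂ (proj₁ geo K K∈𝒦))
    where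
    open ≡-Reasoning
    from-delsarte : Σ ℕ (λ s → Card (_∈ K) s × ℕ→ℚ s * θ ≡ θ - ℕ→ℚ k) → sum 𝟙[ K ] ≡ σ
    from-delsarte (s , card , sθ≡θ-k) = begin
      sum 𝟙[ K ]              ≡⟨ sum-indicator 𝟙[ K ] card (λ z → 𝟙-yes (z ∈? K)) (λ z → 𝟙-no (z ∈? K)) ⟩
      ℕ→ℚ s                   ≡⟨ ⁻¹-cancelˡ (ℕ→ℚ s) θ≢0 ⟨
      θ ⁻¹ * (θ * ℕ→ℚ s)      ≡⟨ cong (θ ⁻¹ *_) (trans (*-comm θ (ℕ→ℚ s)) sθ≡θ-k) ⟩
      θ ⁻¹ * (θ - ℕ→ℚ k)      ≡⟨ *-comm (θ ⁻¹) (θ - ℕ→ℚ k) ⟩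
      σ                       ∎

  [σ-1]θ≡-k : (σ - 1ℚ) * θ ≡ - ℕ→ℚ k
  [σ-1]θ≡-k = begin
    ((θ - ℕ→ℚ k) * θ ⁻¹ - 1ℚ) * θ          ≡⟨ expand θ (ℕ→ℚ k) (θ ⁻¹) ⟩
    (θ - ℕ→ℚ k) * (θ * θ ⁻¹) - θ           ≡⟨ cong (λ e → (θ - ℕ→ℚ k) * e - θ) (⁻¹-inverseʳ θ≢0) ⟩
    (θ - ℕ→ℚ k) * 1ℚ - θ                   ≡⟨ simplify θ (ℕ→ℚ k) ⟩
    - ℕ→ℚ k                                ∎
    where
    open ≡-Reasoning
    expand : ∀ t k i → ((t - k) * i - 1ℚ) * t ≡ (t - k) * (t * i) - t
    expand = solve-∀ ℚ-ring
    simplify : ∀ t k → (t - k) * 1ℚ - t ≡ - k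
    simplify = solve-∀ ℚ-ring

  module _ {x z : Fin n} (x≢z : x ≢ z) (y : Fin n) where

    private
      L R : ℚ
      L = A x y * 𝟙[ clique x y ] z
      R = A x z * (𝟙[ clique x z ] y - δ x y)

      L≡0 : ¬ (Adj G x y × z ∈ clique x y) → L ≡ 0ℚ
      L≡0 ¬P = cases (Adj? G x y) (z ∈? clique x y)
        where
        cases : Dec (Adj G x y) → Dec (z ∈ clique x y) → L ≡ 0ℚ
        cases (yes xy)  (yes z∈) = ⊥-elim (¬P (xy , z∈))
        cases (yes _)   (no z∉)  = trans (cong (A x y *_) (𝟙-no (z ∈? clique x y) z∉)) (*-zeroʳ (A x y))
        cases (no ¬xy)  _        = trans (cong (_* 𝟙[ clique x y ] z) (AdjMat-¬adj G ¬xy)) (*-zeroˡ (𝟙[ clique x y ] z))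

      R≡0 : ¬ (Adj G x z × y ∈ clique x z × x ≢ y) → R ≡ 0ℚ
      R≡0 ¬Q = cases (Adj? G x z) (x ≟ y) (y ∈? clique x z)
        where
        d = 𝟙[ clique x z ] y - δ x y
        cases : Dec (Adj G x z) → Dec (x ≡ y) → Dec (y ∈ clique x z) → R ≡ 0ℚ
        cases (no ¬xz) _ _ = trans (cong (_* d) (AdjMat-¬adj G ¬xz)) (*-zeroˡ d)
        cases (yes xz) (yes refl) _ =
          trans (cong₂ (λ e e′ → A x z * (e - e′)) (𝟙-yes (x ∈? clique x z) (clique∋ˡ xz)) (𝟙-yes (x ≟ x) refl))
                (trans (cong (A x z *_) (+-inverseʳ 1ℚ)) (*-zeroʳ (A x z)))
        cases (yes xz) (no x≢y) (yes y∈) = ⊥-elim (¬Q (xz , y∈ , x≢y))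
        cases (yes xz) (no x≢y) (no y∉) =
          trans (cong₂ (λ e e′ → A x z * (e - e′)) (𝟙-no (y ∈? clique x z) y∉) (𝟙-no (x ≟ y) x≢y))
                (trans (cong (A x z *_) (+-inverseʳ 0ℚ)) (*-zeroʳ (A x z)))

    incidence-cases : (L ≡ 0ℚ × R ≡ 0ℚ) ⊎ (L ≡ 1ℚ × R ≡ 1ℚ × clique x y ≡ clique x z)
    incidence-cases = cases (Adj? G x y) (z ∈? clique x y)
      where
      cases : Dec (Adj G x y) → Dec (z ∈ clique x y) → (L ≡ 0ℚ × R ≡ 0ℚ) ⊎ (L ≡ 1ℚ × R ≡ 1ℚ × clique x y ≡ clique x z)
      cases (no ¬xy) _ =
        inj₁ (L≡0 (λ (xy , _) → ¬xy xy) , R≡0 (λ (xz , y∈ , x≢y) → ¬xy (proj₁ (clique-through xz y∈ x≢y))))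
      cases (yes xy) (no z∉) = inj₁ (L≡0 (λ (_ , z∈) → z∉ z∈) , R≡0 z∉-from)
        where
        z∉-from : ¬ (Adj G x z × y ∈ clique x z × x ≢ y)
        z∉-from (xz , y∈ , x≢y) = z∉ (subst (z ∈_) (sym (proj₂ (clique-through xz y∈ x≢y))) (clique∋ʳ xz))
      cases (yes xy) (yes z∈) = inj₂ (L≡1 , R≡1 , sym same)
        where
        xz = proj₁ (clique-through xy z∈ x≢z)
        same = proj₂ (clique-through xy z∈ x≢z)
        L≡1 : L ≡ 1ℚ
        L≡1 = trans (cong₂ _*_ (AdjMat-adj G xy) (𝟙-yes (z ∈? clique x y) z∈)) (*-identityˡ 1ℚ)
        R≡1 : R ≡ 1ℚ
        R≡1 = trans (cong₂ (λ a e → a * (e - δ x y)) (AdjMat-adj G xz)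
                           (𝟙-yes (y ∈? clique x z) (subst (y ∈_) (sym same) (clique∋ʳ xy))))
                    (trans (cong (λ e → 1ℚ * (1ℚ - e)) (𝟙-no (x ≟ y) (Adj-irrefl G xy))) (*-identityˡ (1ℚ - 0ℚ)))

    incidence-pointwise : ∀ (h : Subset n → ℚ) → L * h (clique x y) ≡ R * h (clique x z)
    incidence-pointwise h = by-cases incidence-cases
      where
      by-cases : (L ≡ 0ℚ × R ≡ 0ℚ) ⊎ (L ≡ 1ℚ × R ≡ 1ℚ × clique x y ≡ clique x z) → L * h (clique x y) ≡ R * h (clique x z)
      by-cases (inj₁ (L≡0 , R≡0)) = trans (cong (_* h (clique x y)) L≡0)
        (trans (*-zeroˡ (h (clique x y))) (sym (trans (cong (_* h (clique x z)) R≡0) (*-zeroˡ (h (clique x z))))))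
      by-cases (inj₂ (L≡1 , R≡1 , same)) = trans (cong₂ _*_ L≡1 (cong h same)) (cong (_* h (clique x z)) (sym R≡1))

  -- For z ≢ x, the y adjacent to x with z ∈ clique x y are the σ - 1 vertices of clique x z other than x.
  incidence : ∀ x z (h : Subset n → ℚ) →
    sum (λ y → A x y * 𝟙[ clique x y ] z * h (clique x y)) ≡
      δ x z * sum (λ y → A x y * h (clique x y)) + (σ - 1ℚ) * (A x z * h (clique x z))
  incidence x z h = by-cases (x ≟ z)
    where
    open ≡-Reasoning
    S = sum (λ y → A x y * h (clique x y))
    by-cases : Dec (x ≡ z) → sum (λ y → A x y * 𝟙[ clique x y ] z * h (clique x y)) ≡
      δ x z * S + (σ - 1ℚ) * (A x z * h (clique x z))
    by-cases (yes refl) = begin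
      sum (λ y → A x y * 𝟙[ clique x y ] x * h (clique x y))   ≡⟨ sum-cong-≗ (λ y → cong (_* h (clique x y)) (x∈ y)) ⟩
      S                                                       ≡⟨ drop S (σ - 1ℚ) (h (clique x x)) ⟩
      1ℚ * S + (σ - 1ℚ) * (0ℚ * h (clique x x))
        ≡⟨ cong₂ (λ e a → e * S + (σ - 1ℚ) * (a * h (clique x x))) (𝟙-yes (x ≟ x) refl) (AdjMat-irrefl G x) ⟨
      δ x x * S + (σ - 1ℚ) * (A x x * h (clique x x))          ∎
      where
      x∈ : ∀ y → A x y * 𝟙[ clique x y ] x ≡ A x y
      x∈ y = trans (AdjMat-*-cong G (λ xy → 𝟙-yes (x ∈? clique x y) (clique∋ˡ xy))) (*-identityʳ (A x y))
      drop : ∀ s c u → s ≡ 1ℚ * s + c * (0ℚ * u)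
      drop = solve-∀ ℚ-ring
    by-cases (no x≢z) = begin
      sum (λ y → A x y * 𝟙[ clique x y ] z * h (clique x y))   ≡⟨ sum-cong-≗ (λ y → incidence-pointwise x≢z y h) ⟩
      sum (λ y → A x z * d y * H)                             ≡⟨ sum-cong-≗ (λ y → rearrange (A x z) (d y) H) ⟩
      sum (λ y → H * A x z * d y)                             ≡⟨ sum-*ˡ (H * A x z) d ⟩
      H * A x z * sum d                                       ≡⟨ *-assoc H (A x z) (sum d) ⟩
      H * (A x z * sum d)                                     ≡⟨ cong (H *_) (AdjMat-*-cong G size) ⟩
      H * (A x z * (σ - 1ℚ))                                  ≡⟨ finish S (σ - 1ℚ) (A x z) H ⟩
      0ℚ * S + (σ - 1ℚ) * (A x z * H)                         ≡⟨ cong (λ e → e * S + (σ - 1ℚ) * (A x z * H)) (𝟙-no (x ≟ z) x≢z) ⟨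
      δ x z * S + (σ - 1ℚ) * (A x z * H)                      ∎
      where
      H = h (clique x z)
      d : Fin n → ℚ
      d y = 𝟙[ clique x z ] y - δ x y
      size : Adj G x z → sum d ≡ σ - 1ℚ
      size xz = trans (sum-distrib-- 𝟙[ clique x z ] (δ x)) (cong₂ _-_ (clique-size (clique∈𝒦 xz)) (sum-δ-1 x))
      rearrange : ∀ a e u → a * e * u ≡ u * a * e
      rearrange = solve-∀ ℚ-ring
      finish : ∀ s c a u → u * (a * c) ≡ 0ℚ * s + c * (a * u)
      finish = solve-∀ ℚ-ring

  module _ {f : Fin n → ℚ} (eigen : IsEigenvector A θ f) where

    cliqueSum : Subset n → ℚ
    cliqueSum K = sum (λ z → 𝟙[ K ] z * f z)

    exchange : ∀ x (H : Subset n → ℚ) →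
      sum (λ y → A x y * H (clique x y) * cliqueSum (clique x y)) ≡
        sum (λ z → (δ x z * sum (λ y → A x y * H (clique x y)) + (σ - 1ℚ) * (A x z * H (clique x z))) * f z)
    exchange x H = begin
      sum (λ y → A x y * H (clique x y) * cliqueSum (clique x y))
        ≡⟨ sum-cong-≗ (λ y → trans (sym (sum-*ˡ (A x y * H (clique x y)) (λ z → 𝟙[ clique x y ] z * f z)))
                                   (sum-cong-≗ (λ z → regroup (A x y) (H (clique x y)) _ (f z)))) ⟩
      sum (λ y → sum (λ z → A x y * 𝟙[ clique x y ] z * H (clique x y) * f z))
        ≡⟨ ∑-comm (λ y z → A x y * 𝟙[ clique x y ] z * H (clique x y) * f z) ⟩
      sum (λ z → sum (λ y → A x y * 𝟙[ clique x y ] z * H (clique x y) * f z))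
        ≡⟨ sum-cong-≗ (λ z → trans (sum-*ʳ (f z) (λ y → A x y * 𝟙[ clique x y ] z * H (clique x y)))
                                   (cong (_* f z) (incidence x z H))) ⟩
      sum (λ z → (δ x z * sum (λ y → A x y * H (clique x y)) + (σ - 1ℚ) * (A x z * H (clique x z))) * f z)  ∎
      where
      open ≡-Reasoning
      regroup : ∀ a u e v → a * u * (e * v) ≡ a * e * u * v
      regroup = solve-∀ ℚ-ring

    neighbourCliqueSums : Fin n → ℚ
    neighbourCliqueSums x = sum (λ y → A x y * cliqueSum (clique x y))

    neighbourCliqueSums≡0 : ∀ x → neighbourCliqueSums x ≡ 0ℚ
    neighbourCliqueSums≡0 x = begin
      neighbourCliqueSums x                                       ≡⟨ sum-cong-≗ (λ y → cong (_* cliqueSum (clique x y)) (*-identityʳ (A x y))) ⟨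
      sum (λ y → A x y * 1ℚ * cliqueSum (clique x y))             ≡⟨ exchange x (λ _ → 1ℚ) ⟩
      sum (λ z → (δ x z * sum (λ y → A x y * 1ℚ) + (σ - 1ℚ) * (A x z * 1ℚ)) * f z)
        ≡⟨ sum-cong-≗ (λ z → trans (cong (λ s → (δ x z * s + (σ - 1ℚ) * (A x z * 1ℚ)) * f z) degree′)
                                   (spread (δ x z) (ℕ→ℚ k) (σ - 1ℚ) (A x z) (f z))) ⟩
      sum (λ z → ℕ→ℚ k * (δ x z * f z) + (σ - 1ℚ) * (A x z * f z))
        ≡⟨ ∑-distrib-+ (λ z → ℕ→ℚ k * (δ x z * f z)) (λ z → (σ - 1ℚ) * (A x z * f z)) ⟩
      sum (λ z → ℕ→ℚ k * (δ x z * f z)) + sum (λ z → (σ - 1ℚ) * (A x z * f z))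
        ≡⟨ cong₂ _+_ (sum-*ˡ (ℕ→ℚ k) (λ z → δ x z * f z)) (sum-*ˡ (σ - 1ℚ) (λ z → A x z * f z)) ⟩
      ℕ→ℚ k * sum (λ z → δ x z * f z) + (σ - 1ℚ) * sum (λ z → A x z * f z)
        ≡⟨ cong₂ (λ p q → ℕ→ℚ k * p + (σ - 1ℚ) * q) (sum-δ x f) (eigen x) ⟩
      ℕ→ℚ k * f x + (σ - 1ℚ) * (θ * f x)                          ≡⟨ collect (ℕ→ℚ k) (σ - 1ℚ) θ (f x) ⟩
      (ℕ→ℚ k + (σ - 1ℚ) * θ) * f x                                ≡⟨ cong (λ t → (ℕ→ℚ k + t) * f x) [σ-1]θ≡-k ⟩
      (ℕ→ℚ k - ℕ→ℚ k) * f x                                       ≡⟨ cong (_* f x) (+-inverseʳ (ℕ→ℚ k)) ⟩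
      0ℚ * f x                                                    ≡⟨ *-zeroˡ (f x) ⟩
      0ℚ                                                          ∎
      where
      open ≡-Reasoning
      degree′ : sum (λ y → A x y * 1ℚ) ≡ ℕ→ℚ k
      degree′ = trans (sum-cong-≗ (λ y → *-identityʳ (A x y))) (degree G reg x)
      spread : ∀ e k c a u → (e * k + c * (a * 1ℚ)) * u ≡ k * (e * u) + c * (a * u)
      spread = solve-∀ ℚ-ring
      collect : ∀ k c t u → k * u + c * (t * u) ≡ (k + c * t) * u
      collect = solve-∀ ℚ-ring

    sum-edge-cliqueSum²≡0 : sum (λ x → sum (λ y → A x y * cliqueSum (clique x y) * cliqueSum (clique x y))) ≡ 0ℚ
    sum-edge-cliqueSum²≡0 = begin
      sum (λ x → sum (λ y → A x y * S x y * S x y))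
        ≡⟨ sum-cong-≗ row ⟩
      sum (λ x → sum (λ z → (σ - 1ℚ) * (A x z * S x z) * f z))
        ≡⟨ ∑-comm (λ x z → (σ - 1ℚ) * (A x z * S x z) * f z) ⟩
      sum (λ z → sum (λ x → (σ - 1ℚ) * (A x z * S x z) * f z))
        ≡⟨ sum-cong-≗ column ⟩
      sum {n} (λ _ → 0ℚ)
        ≡⟨ sum-zero n ⟩
      0ℚ ∎
      where
      open ≡-Reasoning
      S : Fin n → Fin n → ℚ
      S x y = cliqueSum (clique x y)
      drop-g : ∀ e c a s u → (e * 0ℚ + c * (a * s)) * u ≡ c * (a * s) * u
      drop-g = solve-∀ ℚ-ring
      row : ∀ x → sum (λ y → A x y * S x y * S x y) ≡ sum (λ z → (σ - 1ℚ) * (A x z * S x z) * f z)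
      row x = trans (exchange x cliqueSum) (sum-cong-≗ (λ z →
        trans (cong (λ t → (δ x z * t + (σ - 1ℚ) * (A x z * S x z)) * f z) (neighbourCliqueSums≡0 x))
              (drop-g (δ x z) (σ - 1ℚ) (A x z) (S x z) (f z))))
      S-sym : ∀ x z → A x z * S x z ≡ A z x * S z x
      S-sym x z = trans (AdjMat-*-cong G (λ xz → cong cliqueSum (clique-sym xz))) (cong (_* S z x) (AdjMat-sym G x z))
      column : ∀ z → sum (λ x → (σ - 1ℚ) * (A x z * S x z) * f z) ≡ 0ℚ
      column z = begin
        sum (λ x → (σ - 1ℚ) * (A x z * S x z) * f z)     ≡⟨ sum-*ʳ (f z) (λ x → (σ - 1ℚ) * (A x z * S x z)) ⟩
        sum (λ x → (σ - 1ℚ) * (A x z * S x z)) * f z     ≡⟨ cong (_* f z) (sum-*ˡ (σ - 1ℚ) (λ x → A x z * S x z)) ⟩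
        (σ - 1ℚ) * sum (λ x → A x z * S x z) * f z
          ≡⟨ cong (λ t → (σ - 1ℚ) * t * f z) (trans (sum-cong-≗ (λ x → S-sym x z)) (neighbourCliqueSums≡0 z)) ⟩
        (σ - 1ℚ) * 0ℚ * f z                              ≡⟨ cong (_* f z) (*-zeroʳ (σ - 1ℚ)) ⟩
        0ℚ * f z                                         ≡⟨ *-zeroˡ (f z) ⟩
        0ℚ                                               ∎

    cliqueSum-edge≡0 : ∀ {x y} → Adj G x y → cliqueSum (clique x y) ≡ 0ℚ
    cliqueSum-edge≡0 {x} {y} xy = x*x≡0⇒x≡0 (begin
      S * S              ≡⟨ *-identityˡ (S * S) ⟨
      1ℚ * (S * S)       ≡⟨ cong (_* (S * S)) (AdjMat-adj G xy) ⟨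
      A x y * (S * S)    ≡⟨ *-assoc (A x y) S S ⟨
      A x y * S * S      ≡⟨ sum≡0⇒≡0 (term≥0 x) (sum≡0⇒≡0 (λ x → sum-nonNeg (term≥0 x)) sum-edge-cliqueSum²≡0 x) y ⟩
      0ℚ                 ∎)
      where
      open ≡-Reasoning
      S = cliqueSum (clique x y)
      term≥0 : ∀ x y → 0ℚ ≤ A x y * cliqueSum (clique x y) * cliqueSum (clique x y)
      term≥0 x y = subst (0ℚ ≤_) (sym (*-assoc (A x y) _ _)) (0≤x*y (AdjMat-nonNeg G x y) (0≤x*x (cliqueSum (clique x y))))

    cliqueSum≡0 : ∀ {K} → 𝒦 K → ∀ {x y} → x ∈ K → y ∈ K → x ≢ y → cliqueSum K ≡ 0ℚ
    cliqueSum≡0 {K} K∈𝒦 {x} {y} x∈K y∈K x≢y =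
      trans (cong cliqueSum (clique-unique xy K K∈𝒦 x∈K y∈K)) (cliqueSum-edge≡0 xy)
      where
      xy : Adj G x y
      xy = proj₁ (proj₁ geo K K∈𝒦) x y x∈K y∈K x≢y

ConstantCliqueIntersection : ∀ {n} → Graph n → Subset n → (Subset n → Set) → ℕ → ℚ → Set
ConstantCliqueIntersection G C 𝒦 i a = (a ≢ 0ℚ) ×
  (∀ K → 𝒦 K → (∀ x → x ∈ K → DistC G C x i ⊎ DistC G C x (suc i)) →
     Σ ℕ λ m → Card (λ x → x ∈ K × DistC G C x i) m × ℕ→ℚ m ≡ a)

module TheoremSetting {n} (G : Graph n) {d b c} (drg : IsDRG G d b c) {k} (reg : Regular G k) {θ}
  (minE : IsMinEigenvalue (AdjMat G) θ) {𝒦} (geo : IsGeometric G k θ 𝒦) (C : Subset n) {ρ α β γ}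
  (cr : IsCompletelyRegular G C ρ α β γ) (spec : InSpec θ α β γ) (i : ℕ) (i<ρ : i ℕ.< ρ) where

  open CompletelyRegularCode G (IsDRG.connected drg) reg C cr
  open Recurrence k ρ β γ

  x₀ y₀ : Fin n
  x₀ = proj₁ (edge-between-levels i i<ρ)
  y₀ = proj₁ (proj₂ (edge-between-levels i i<ρ))

  dx₀ : DistC G C x₀ i
  dx₀ = proj₁ (proj₂ (proj₂ (edge-between-levels i i<ρ)))

  dy₀ : DistC G C y₀ (suc i)
  dy₀ = proj₁ (proj₂ (proj₂ (proj₂ (edge-between-levels i i<ρ))))

  x₀y₀ : Adj G x₀ y₀
  x₀y₀ = proj₂ (proj₂ (proj₂ (proj₂ (edge-between-levels i i<ρ))))

  K₀ : Subset n
  K₀ = proj₁ (proj₂ geo x₀ y₀ x₀y₀)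

  K₀∈𝒦 : 𝒦 K₀
  K₀∈𝒦 = proj₁ (proj₂ (proj₂ geo x₀ y₀ x₀y₀))

  x₀∈K₀ : x₀ ∈ K₀
  x₀∈K₀ = proj₁ (proj₂ (proj₂ (proj₂ geo x₀ y₀ x₀y₀)))

  y₀∈K₀ : y₀ ∈ K₀
  y₀∈K₀ = proj₁ (proj₂ (proj₂ (proj₂ (proj₂ geo x₀ y₀ x₀y₀))))

  K₀-shape : ∃[ j ] (1 ℕ.≤ j × Card (_∈ K₀) (suc j) × ℕ→ℚ j * θ ≡ - ℕ→ℚ k)
  K₀-shape = delsarte-clique-size G {k} {θ} (proj₁ geo K₀ K₀∈𝒦) x₀∈K₀ y₀∈K₀ (Adj-irrefl G x₀y₀)

  j₀ : ℕ
  j₀ = proj₁ K₀-shape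

  1≤j₀ : 1 ℕ.≤ j₀
  1≤j₀ = proj₁ (proj₂ K₀-shape)

  j₀θ≡-k : ℕ→ℚ j₀ * θ ≡ - ℕ→ℚ k
  j₀θ≡-k = proj₂ (proj₂ (proj₂ K₀-shape))

  j₀≤k : j₀ ℕ.≤ k
  j₀≤k = ℕ.≤-pred (clique-size≤1+k G reg (proj₁ (proj₁ geo K₀ K₀∈𝒦)) x₀∈K₀ (proj₁ (proj₂ (proj₂ K₀-shape))))

  θ≢0 : θ ≢ 0ℚ
  θ≢0 θ≡0 = ℕ→ℚ-≢0 (Card-nonempty (reg x₀) x₀y₀)
    (neg-injective (trans (sym j₀θ≡-k) (trans (cong (ℕ→ℚ j₀ *_) θ≡0) (*-zeroʳ (ℕ→ℚ j₀)))))

  α≡a : ∀ j → j ℕ.≤ ρ → α[ j ] ≡ a[ j ]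
  α≡a j j≤ρ = trans (isolate α[ j ] β[ j ] γ[ j ]) (cong (λ t → t - β[ j ] - γ[ j ]) (α+β+γ≡k j j≤ρ))
    where
    isolate : ∀ a b c → a ≡ a + b + c - b - c
    isolate = solve-∀ ℚ-ring

  χθ≡0 : χ θ ≡ 0ℚ
  χθ≡0 = root (IntersectionMatrixRows.InSpec⇒eigensequence α β γ {θ} spec)
    where
    root : Σ (ℕ → ℚ) (λ W → Eigensequence (IntersectionMatrixRows.α[_] α β γ) θ W × ∃[ j ] (j ℕ.≤ ρ × W j ≢ 0ℚ)) →
      χ θ ≡ 0ℚ
    root (W , rows , j , j≤ρ , Wj≢0) = eigensequence⇒χ≡0 β≢0 {θ} {W} (Eigensequence-cong {θ = θ} {v = W} α≡a rows) j≤ρ Wj≢0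

  θ≡θ₀ : θ ≡ delsarte-eigenvalue k j₀
  θ≡θ₀ = delsarte-eigenvalue-unique k 1≤j₀ j₀θ≡-k

  j*-spec : 1 ℕ.≤ j* × j* ℕ.≤ j₀ × χ θ* ≡ 0ℚ
  j*-spec = least-correct (λ j → χ (delsarte-eigenvalue k j) ≟ℚ 0ℚ) 1 k 1≤j₀ (s≤s j₀≤k)
              (subst (λ t → χ t ≡ 0ℚ) θ≡θ₀ χθ≡0)

  1≤j* : 1 ℕ.≤ j*
  1≤j* = proj₁ j*-spec

  f* : Fin n → ℚ
  f* x = v θ* (level x)

  f*-eigen : IsEigenvector (AdjMat G) θ* f*
  f*-eigen = eigensequence⇒eigenvector {θ*} {v θ*}
    (Eigensequence-cong {θ = θ*} {v = v θ*} (λ j j≤ρ → sym (α≡a j j≤ρ)) (v-eigensequence β≢0 {θ*} (proj₂ (proj₂ j*-spec))))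

  -- θ = -k/j₀ is a root of χ, so j* ≤ j₀; conversely θ* is an eigenvalue of Γ, and θ is the least one.
  θ≡θ* : θ ≡ θ*
  θ≡θ* = ≤-antisym θ≤θ* θ*≤θ
    where
    x = proj₁ (level-nonempty 0 z≤n)
    f*x≢0 : f* x ≢ 0ℚ
    f*x≢0 e = 1≢0 (trans (cong (v θ*) (sym (level-unique (proj₂ (level-nonempty 0 z≤n))))) e)
    θ≤θ* : θ ≤ θ*
    θ≤θ* = IsMinEigenvalue⇒≤ {M = AdjMat G} {θ} {θ*} {f*} minE f*-eigen f*x≢0
    θ*≤θ : θ* ≤ θ
    θ*≤θ = subst (θ* ≤_) (sym θ≡θ₀) (delsarte-eigenvalue-mono k 1≤j* (proj₁ (proj₂ j*-spec)))

  f*-eigen-θ : IsEigenvector (AdjMat G) θ f*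
  f*-eigen-θ = subst (λ t → IsEigenvector (AdjMat G) t f*) (sym θ≡θ*) f*-eigen

  [1+j*]θ≡θ-k : ℕ→ℚ (suc j*) * θ ≡ θ - ℕ→ℚ k
  [1+j*]θ≡θ-k = begin
    ℕ→ℚ (suc j*) * θ          ≡⟨ cong (_* θ) (ℕ→ℚ-suc j*) ⟩
    (1ℚ + ℕ→ℚ j*) * θ         ≡⟨ distrib θ (ℕ→ℚ j*) ⟩
    θ + ℕ→ℚ j* * θ            ≡⟨ cong (λ t → θ + ℕ→ℚ j* * t) θ≡θ* ⟩
    θ + ℕ→ℚ j* * θ*           ≡⟨ cong (θ +_) (delsarte-eigenvalue-* k 1≤j*) ⟩
    θ - ℕ→ℚ k                 ∎
    where
    open ≡-Reasoning
    distrib : ∀ t j → (1ℚ + j) * t ≡ t + j * t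
    distrib = solve-∀ ℚ-ring

  Card-clique : ∀ {K} → 𝒦 K → Card (_∈ K) (suc j*)
  Card-clique {K} K∈𝒦 = resize (proj₂ (proj₁ geo K K∈𝒦))
    where
    resize : Σ ℕ (λ s → Card (_∈ K) s × ℕ→ℚ s * θ ≡ θ - ℕ→ℚ k) → Card (_∈ K) (suc j*)
    resize (s , card , sθ≡θ-k) =
      subst (Card (_∈ K)) (ℕ→ℚ-injective (*-cancelʳ-≢0 θ≢0 (trans sθ≡θ-k (sym [1+j*]θ≡θ-k)))) card

  open GeometricGraph G geo reg θ≢0 using (cliqueSum≡0)

  count-in-clique : ∀ K → 𝒦 K → (∀ z → z ∈ K → DistC G C z i ⊎ DistC G C z (suc i)) →
    Σ ℕ λ m → Card (λ z → z ∈ K × DistC G C z i) m × ℕ→ℚ m ≡ coefficient i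
  count-in-clique K K∈𝒦 K⊆ = ∣ K ∩level i ∣ , Card-∩level K i ,
    balance⇒count β≢0 γ≢0 θ* i {s} {m} i<ρ (ℕ→ℚ-≢0 {suc j*} (s≤s z≤n)) balance
    where
    open ≡-Reasoning
    m m′ s : ℚ
    m = ℕ→ℚ ∣ K ∩level i ∣
    m′ = ℕ→ℚ ∣ K ∩level suc i ∣
    s = ℕ→ℚ (suc j*)
    size : m + m′ ≡ s
    size = begin
      m + m′                                 ≡⟨ cong₂ _+_ (*-identityʳ m) (*-identityʳ m′) ⟨
      m * 1ℚ + m′ * 1ℚ                       ≡⟨ sum-over-two-levels K i K⊆ (λ _ → 1ℚ) ⟨
      sum (λ z → 𝟙 (z ∈? K) * 1ℚ)            ≡⟨ sum-indicator _ (Card-clique K∈𝒦)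
                                                  (λ z z∈K → trans (*-identityʳ _) (𝟙-yes (z ∈? K) z∈K))
                                                  (λ z z∉K → trans (*-identityʳ _) (𝟙-no (z ∈? K) z∉K)) ⟩
      s                                      ∎
    vanishes : ∃[ x ] ∃[ y ] (x ∈ K × y ∈ K × x ≢ y) → sum (λ z → 𝟙 (z ∈? K) * f* z) ≡ 0ℚ
    vanishes (_ , _ , x∈K , y∈K , x≢y) = cliqueSum≡0 {f = f*} f*-eigen-θ K∈𝒦 x∈K y∈K x≢y
    balance : m * v θ* i + (s - m) * v θ* (suc i) ≡ 0ℚ
    balance = begin
      m * v θ* i + (s - m) * v θ* (suc i)     ≡⟨ cong (λ t → m * v θ* i + (t - m) * v θ* (suc i)) size ⟨
      m * v θ* i + (m + m′ - m) * v θ* (suc i) ≡⟨ cong (λ t → m * v θ* i + t * v θ* (suc i)) (x+y-x≡y m m′) ⟩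
      m * v θ* i + m′ * v θ* (suc i)          ≡⟨ sum-over-two-levels K i K⊆ (v θ*) ⟨
      sum (λ z → 𝟙 (z ∈? K) * f* z)           ≡⟨ vanishes (Card-two⁻ (Card-clique K∈𝒦) (s≤s 1≤j*)) ⟩
      0ℚ                                      ∎
      where
      x+y-x≡y : ∀ x y → x + y - x ≡ y
      x+y-x≡y = solve-∀ ℚ-ring

  coefficient≢0 : coefficient i ≢ 0ℚ
  coefficient≢0 = subst (_≢ 0ℚ) m≡a (ℕ→ℚ-≢0 (Card-nonempty card (x₀∈K₀ , dx₀)))
    where
    K₀⊆ = clique-levels (proj₁ (proj₁ geo K₀ K₀∈𝒦)) x₀∈K₀ y₀∈K₀ dx₀ dy₀
    card = proj₁ (proj₂ (count-in-clique K₀ K₀∈𝒦 K₀⊆))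
    m≡a = proj₂ (proj₂ (count-in-clique K₀ K₀∈𝒦 K₀⊆))

  constant-clique-intersection : ConstantCliqueIntersection G C 𝒦 i (coefficient i)
  constant-clique-intersection = coefficient≢0 , count-in-clique

  b₀≡k : at b 0 ≡ k
  b₀≡k = valency≡b₀ G drg reg x₀y₀

theorem3 : Σ ((d : ℕ) → Vec ℕ d → Vec ℕ d → (ρ : ℕ) → Vec ℕ ρ → Vec ℕ ρ → ℕ → ℚ) λ a →
  ∀ {n} (G : Graph n) (d : ℕ) (b c : Vec ℕ d) (k : ℕ) (θ : ℚ) (𝒦 : Subset n → Set)
    (C : Subset n) (ρ : ℕ) (α : Vec ℕ (suc ρ)) (β γ : Vec ℕ ρ) →
    IsDRG G d b c → Regular G k → IsMinEigenvalue (AdjMat G) θ →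
    IsGeometric G k θ 𝒦 →
    IsCompletelyRegular G C ρ α β γ → InSpec θ α β γ →
    ∀ i → i < ρ →
      (a d b c ρ β γ i ≢ 0ℚ) ×
      (∀ K → 𝒦 K → (∀ x → x ∈ K → DistC G C x i ⊎ DistC G C x (suc i)) →
         Σ ℕ λ m → Card (λ x → x ∈ K × DistC G C x i) m × ℕ→ℚ m ≡ a d b c ρ β γ i)
theorem3 = (λ d b c ρ β γ i → Recurrence.coefficient (at b 0) ρ β γ i) ,
  λ G d b c k θ 𝒦 C ρ α β γ drg reg minE geo cr spec i i<ρ →
    let open TheoremSetting G drg reg minE geo C cr spec i i<ρ in
    subst (λ k′ → ConstantCliqueIntersection G C 𝒦 i (Recurrence.coefficient k′ ρ β γ i)) (sym b₀≡k)
          constant-clique-intersection
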